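{- Let $n$ and $r$ be even nonnegative integers, and suppose that either ($n \geq 52$ and $r < 2(n+2)/3$) or ($n < 52$ and $r < n-16$). Then every $r$-regular simple graph $G$ on $n$ vertices can be extended to an $(r+1)$-regular graph on $n$ vertices, i.e., there is a set $F$ of edges of the complement $G^c$ such that $(V(G), E(G)\cup F)$ is $(r+1)$-regular.
   Context: All graphs are finite and simple. "Extending $G(n,r)$ to $G(n,r+1)$" means adding edges (not already present) to an $r$-regular graph on $n$ vertices, keeping the same vertex set, so that the resulting graph is $(r+1)$-regular. -}

module Defs where

open import Data.Nat using (ℕ; zero; suc; _+_)
open import Data.Bool using (Bool; true; false; if_then_else_)
open import Data.Fin using (Fin) renaming (zero to fzero; suc to fsuc)
open import Relation.Binary.PropositionalEquality using (_≡_)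
open import Data.Product using (Σ; _×_)

record SimpleGraph (n : ℕ) : Set where
  field
    adj   : Fin n → Fin n → Bool
    sym   : ∀ u v → adj u v ≡ adj v u
    loopless : ∀ v → adj v v ≡ false
open SimpleGraph public

countTrue : ∀ {n} → (Fin n → Bool) → ℕ
countTrue {zero} f = 0
countTrue {suc n} f = (if f fzero then 1 else 0) + countTrue (λ i → f (fsuc i))

degree : ∀ {n} → SimpleGraph n → Fin n → ℕ
degree G v = countTrue (adj G v)

Regular : ∀ {n} → ℕ → SimpleGraph n → Set
Regular r G = ∀ v → degree G v ≡ r

SubgraphOf : ∀ {n} → SimpleGraph n → SimpleGraph n → Set
SubgraphOf G H = ∀ u v → adj G u v ≡ true → adj H u v ≡ true

-- F ⊆ E(G^c) (F symmetric, irreflexive) and (V, E(G) ∪ F) is (r+1)-regular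
-- is expressed by: a simple graph H on the same vertices with E(G) ⊆ E(H),
-- H (r+1)-regular; F := E(H) \ E(G).
ExtendsTo : ∀ {n} → SimpleGraph n → ℕ → Set
ExtendsTo {n} G s = Σ (SimpleGraph n) (λ H → SubgraphOf G H × Regular s H)

-- The complement of G is d-regular for the odd number d = n - r - 1, a perfect matching of the
-- complement extends G to an (r+1)-regular graph, and the hypotheses give n ≤ 3d + 5.
-- Following Lovász's proof of Tutte's theorem, every supergraph K of a d-regular graph H on
-- n ≤ 3d + 5 vertices (d odd, n even) has a perfect matching, by induction on the non-edges
-- of K. If a non-full vertex y has non-adjacent neighbours x and z, choose w ≁ y: perfect
-- matchings of K + xz and K + yw recombine along an alternating walk into one of K.
-- Otherwise the non-full vertices form disjoint cliques, and a greedy matching succeeds unless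
-- there are at least |S| + 2 odd cliques, S the set of full vertices. An odd clique sends at
-- least d edges of H into S unless it has at least d + 2 vertices (and then it still sends
-- one); as n ≤ 3d + 5 allows at most two such large cliques, S would receive more than the
-- d|S| edges of H it has.

module Submission where

open import Defs hiding (sym)
open import Data.Nat using (ℕ; _+_; _*_; _≥_; _<_)
open import Data.Nat.Divisibility using (_∣_)
open import Data.Product using (_×_)
open import Data.Sum using (_⊎_)

open import Data.Nat using (zero; suc; _≤_; _∸_; z≤n; s≤s; _<?_; _≤?_; parity)
open import Data.Nat.Divisibility using (divides)
open import Data.Nat.Properties hiding (_≟_)
open import Data.Nat.Tactic.RingSolver using (solve-∀)
open import Data.Parity using (0ℙ; 1ℙ; _⁻¹) renaming (_+_ to _⊕_; _*_ to _⊗_)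
import Data.Parity.Properties as ℙ
open import Data.Bool using (Bool; true; false; not; _∧_; _∨_; if_then_else_)
import Data.Bool.Properties as 𝔹
open import Data.Fin using (Fin; toℕ; fromℕ<) renaming (zero to fzero; suc to fsuc)
import Data.Fin.Properties as FinP
open FinP using (_≟_)
open import Data.Product using (Σ; ∃; _,_; proj₁; proj₂)
open import Data.Sum using (inj₁; inj₂; [_,_]′)
open import Data.Empty using (⊥; ⊥-elim)
open import Function using (_∘_; id)
open import Data.Nat.Induction using (<-rec)
open import Data.Nat.GeneralisedArithmetic using (fold; fold-+; iterate-is-fold)
open import Relation.Nullary using (¬_; Dec; yes; no; does)
open import Relation.Nullary.Decidable using (dec-true; dec-false)
open import Relation.Binary.PropositionalEquality
open import Algebra.Properties.Semiring.Sum +-*-semiring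
  using (sum; sum-cong-≗; ∑-distrib-+; ∑-comm; *-distribˡ-sum)

bool-clash : ∀ {b} → b ≡ true → b ≡ false → ⊥
bool-clash refl ()

≢true⇒≡false : ∀ {b} → ¬ b ≡ true → b ≡ false
≢true⇒≡false {false} _ = refl
≢true⇒≡false {true} h = ⊥-elim (h refl)

∨-elim : ∀ a {b} → (a ∨ b) ≡ true → a ≡ true ⊎ b ≡ true
∨-elim true _ = inj₁ refl
∨-elim false h = inj₂ h

∨-introˡ : ∀ {a} b → a ≡ true → (a ∨ b) ≡ true
∨-introˡ b refl = refl

∨-introʳ : ∀ a {b} → b ≡ true → (a ∨ b) ≡ true
∨-introʳ a refl = 𝔹.∨-zeroʳ a

∧-elim : ∀ a {b} → (a ∧ b) ≡ true → a ≡ true × b ≡ true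
∧-elim true h = refl , h

not-true : ∀ {b} → not b ≡ true → b ≡ false
not-true {false} _ = refl

bool-ext : ∀ {a b} → (a ≡ true → b ≡ true) → (b ≡ true → a ≡ true) → a ≡ b
bool-ext {false} {false} _ _ = refl
bool-ext {false} {true} _ b⇒a = b⇒a refl
bool-ext {true} a⇒b _ = sym (a⇒b refl)

does⇒ : ∀ {A : Set} (d : Dec A) → does d ≡ true → A
does⇒ (yes a) _ = a

does⇒¬ : ∀ {A : Set} (d : Dec A) → does d ≡ false → ¬ A
does⇒¬ (no ¬a) _ = ¬a

_==_ : ∀ {n} → Fin n → Fin n → Bool
i == j = does (i ≟ j)

==-refl : ∀ {n} (i : Fin n) → (i == i) ≡ true
==-refl i = dec-true (i ≟ i) refl

≢⇒==false : ∀ {n} {i j : Fin n} → ¬ i ≡ j → (i == j) ≡ false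
≢⇒==false = dec-false (_ ≟ _)

==⇒≡ : ∀ {n} {i j : Fin n} → (i == j) ≡ true → i ≡ j
==⇒≡ = does⇒ (_ ≟ _)

==-sym : ∀ {n} (i j : Fin n) → (i == j) ≡ (j == i)
==-sym i j with i ≟ j
... | yes refl = sym (==-refl i)
... | no i≢j = sym (≢⇒==false (i≢j ∘ sym))

𝟙 : Bool → ℕ
𝟙 b = if b then 1 else 0

countTrue≡sum : ∀ {n} (f : Fin n → Bool) → countTrue f ≡ sum (𝟙 ∘ f)
countTrue≡sum {zero} f = refl
countTrue≡sum {suc n} f = cong (𝟙 (f fzero) +_) (countTrue≡sum (f ∘ fsuc))

countTrue-cong : ∀ {n} {f g : Fin n → Bool} → (∀ i → f i ≡ g i) → countTrue f ≡ countTrue g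
countTrue-cong {zero} e = refl
countTrue-cong {suc n} e = cong₂ _+_ (cong 𝟙 (e fzero)) (countTrue-cong (e ∘ fsuc))

countTrue-mono : ∀ {n} {f g : Fin n → Bool} → (∀ i → f i ≡ true → g i ≡ true) → countTrue f ≤ countTrue g
countTrue-mono {zero} h = z≤n
countTrue-mono {suc n} {f} {g} h = +-mono-≤ (head (f fzero) (h fzero)) (countTrue-mono (h ∘ fsuc))
  where
    head : ∀ a {b} → (a ≡ true → b ≡ true) → 𝟙 a ≤ 𝟙 b
    head false _ = z≤n
    head true h rewrite h refl = ≤-refl

countTrue-false : ∀ {n} {f : Fin n → Bool} → (∀ i → f i ≡ false) → countTrue f ≡ 0
countTrue-false {zero} h = refl
countTrue-false {suc n} h rewrite h fzero = countTrue-false (h ∘ fsuc)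

countTrue-true : ∀ n → countTrue {n} (λ _ → true) ≡ n
countTrue-true zero = refl
countTrue-true (suc n) = cong suc (countTrue-true n)

countTrue-split : ∀ {n} (f g : Fin n → Bool) →
  countTrue f ≡ countTrue (λ i → f i ∧ g i) + countTrue (λ i → f i ∧ not (g i))
countTrue-split {zero} f g = refl
countTrue-split {suc n} f g
  rewrite countTrue-split (f ∘ fsuc) (g ∘ fsuc) with f fzero | g fzero
... | false | _ = refl
... | true | true = refl
... | true | false = sym (+-suc _ _)

insert : ∀ {n} → Fin n → (Fin n → Bool) → Fin n → Bool
insert a f i = f i ∨ (i == a)

remove : ∀ {n} → Fin n → (Fin n → Bool) → Fin n → Bool
remove a f i = f i ∧ not (i == a)

insert-self : ∀ {n} (a : Fin n) f → insert a f a ≡ true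
insert-self a f rewrite ==-refl a = 𝔹.∨-zeroʳ (f a)

insert-other : ∀ {n} {a i : Fin n} f → ¬ i ≡ a → insert a f i ≡ f i
insert-other {i = i} f i≢a rewrite ≢⇒==false i≢a = 𝔹.∨-identityʳ (f i)

remove-self : ∀ {n} (a : Fin n) f → remove a f a ≡ false
remove-self a f rewrite ==-refl a = 𝔹.∧-zeroʳ (f a)

remove-other : ∀ {n} {a i : Fin n} f → ¬ i ≡ a → remove a f i ≡ f i
remove-other {i = i} f i≢a rewrite ≢⇒==false i≢a = 𝔹.∧-identityʳ (f i)

insert-elim : ∀ {n} {a : Fin n} f i → insert a f i ≡ true → f i ≡ true ⊎ i ≡ a
insert-elim f i h with ∨-elim (f i) h
... | inj₁ fi = inj₁ fi
... | inj₂ i≡a = inj₂ (==⇒≡ i≡a)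

remove-elim : ∀ {n} {a : Fin n} f i → remove a f i ≡ true → f i ≡ true × ¬ i ≡ a
remove-elim {a = a} f i h with ∧-elim (f i) h
... | fi , i≠a = fi , λ { refl → bool-clash (==-refl a) (not-true i≠a) }

remove-intro : ∀ {n} {a : Fin n} f i → f i ≡ true → ¬ i ≡ a → remove a f i ≡ true
remove-intro f i fi i≢a = trans (remove-other f i≢a) fi

countTrue-insert : ∀ {n} (f : Fin n → Bool) (a : Fin n) → f a ≡ false →
  countTrue (insert a f) ≡ suc (countTrue f)
countTrue-insert f fzero fa rewrite fa =
  cong suc (countTrue-cong (λ i → 𝔹.∨-identityʳ (f (fsuc i))))
countTrue-insert f (fsuc a) fa with f fzero
... | true = cong suc (countTrue-insert (f ∘ fsuc) a fa)
... | false = countTrue-insert (f ∘ fsuc) a fa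

countTrue-insert-∧ : ∀ {n} (f g : Fin n → Bool) (a : Fin n) → f a ≡ false →
  countTrue (λ i → insert a f i ∧ g i) ≡ 𝟙 (g a) + countTrue (λ i → f i ∧ g i)
countTrue-insert-∧ f g a fa with g a in ga
... | true = trans (countTrue-cong inserted) (countTrue-insert (λ i → f i ∧ g i) a (cong (_∧ g a) fa))
  where
    inserted : ∀ i → (insert a f i ∧ g i) ≡ insert a (λ i → f i ∧ g i) i
    inserted i with i ≟ a
    ... | yes refl = trans (cong (_∧ g a) (𝔹.∨-zeroʳ (f a))) (trans ga (sym (𝔹.∨-zeroʳ _)))
    ... | no _ = trans (cong (_∧ g i) (𝔹.∨-identityʳ (f i))) (sym (𝔹.∨-identityʳ _))
... | false = countTrue-cong unchanged
  where
    unchanged : ∀ i → (insert a f i ∧ g i) ≡ (f i ∧ g i)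
    unchanged i with i ≟ a
    ... | yes refl = trans (cong (_∧ g a) (𝔹.∨-zeroʳ (f a))) (trans ga (sym (cong (_∧ g a) fa)))
    ... | no _ = cong (_∧ g i) (𝔹.∨-identityʳ (f i))

countTrue-remove : ∀ {n} (f : Fin n → Bool) (a : Fin n) → f a ≡ true →
  countTrue f ≡ suc (countTrue (remove a f))
countTrue-remove f a fa = trans (countTrue-cong reinsert) (countTrue-insert (remove a f) a (remove-self a f))
  where
    reinsert : ∀ i → f i ≡ insert a (remove a f) i
    reinsert i with i ≟ a
    ... | yes refl = trans fa (sym (𝔹.∨-zeroʳ _))
    ... | no _ = sym (trans (𝔹.∨-identityʳ _) (𝔹.∧-identityʳ (f i)))

countTrue-partition : ∀ {n} (f g : Fin n → Bool) → (∀ i → (f i ∨ g i) ≡ true) →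
  (∀ i → f i ≡ true → g i ≡ false) → countTrue f + countTrue g ≡ n
countTrue-partition {n} f g cover disjoint = begin
  countTrue f + countTrue g             ≡⟨ cong (countTrue f +_) (countTrue-cong complement) ⟩
  countTrue f + countTrue (not ∘ f)     ≡⟨ countTrue-split (λ _ → true) f ⟨
  countTrue {n} (λ _ → true)            ≡⟨ countTrue-true n ⟩
  n                                     ∎
  where
    open ≡-Reasoning
    complement : ∀ i → g i ≡ not (f i)
    complement i with f i in fi
    ... | true = disjoint i fi
    ... | false = trans (cong (_∨ g i) (sym fi)) (cover i)

countTrue-pos : ∀ {n} (f : Fin n → Bool) (a : Fin n) → f a ≡ true → 1 ≤ countTrue f
countTrue-pos f a fa rewrite countTrue-remove f a fa = s≤s z≤n

countTrue-mono-< : ∀ {n} {f g : Fin n → Bool} (a : Fin n) →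
  (∀ i → f i ≡ true → g i ≡ true) → f a ≡ false → g a ≡ true → countTrue f < countTrue g
countTrue-mono-< {f = f} {g} a f⊆g fa ga rewrite countTrue-remove g a ga =
  s≤s (countTrue-mono λ i fi →
    cong₂ _∧_ (f⊆g i fi) (cong not (≢⇒==false {i = i} λ { refl → bool-clash fi fa })))

countTrue-witness : ∀ {n} (f : Fin n → Bool) → 0 < countTrue f → ∃ λ a → f a ≡ true
countTrue-witness {suc n} f pos with f fzero in e
... | true = fzero , e
... | false with countTrue-witness (f ∘ fsuc) pos
... | a , fa = fsuc a , fa

countTrue-second : ∀ {n} (f : Fin n → Bool) (a : Fin n) → f a ≡ true → 2 ≤ countTrue f →
  ∃ λ b → f b ≡ true × ¬ b ≡ a
countTrue-second f a fa two with countTrue-witness (remove a f) (≤-pred (subst (2 ≤_) (countTrue-remove f a fa) two))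
... | b , h = b , remove-elim f b h

countTrue-subsingleton : ∀ {n} (f : Fin n → Bool) →
  (∀ i j → f i ≡ true → f j ≡ true → i ≡ j) → countTrue f ≤ 1
countTrue-subsingleton {zero} f _ = z≤n
countTrue-subsingleton {suc n} f uniq with f fzero in e
... | false = countTrue-subsingleton (f ∘ fsuc) λ i j fi fj → FinP.suc-injective (uniq (fsuc i) (fsuc j) fi fj)
... | true = ≤-reflexive (cong suc (countTrue-false only-zero))
  where
    only-zero : ∀ i → f (fsuc i) ≡ false
    only-zero i = ≢true⇒≡false λ fi → case (uniq fzero (fsuc i) e fi)
      where case : fzero ≡ fsuc i → ⊥
            case ()

countTrue-singleton : ∀ {n} (f : Fin n → Bool) (a : Fin n) → f a ≡ true →
  (∀ i → f i ≡ true → i ≡ a) → countTrue f ≡ 1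
countTrue-singleton f a fa only-a =
  ≤-antisym (countTrue-subsingleton f λ i j fi fj → trans (only-a i fi) (sym (only-a j fj)))
            (countTrue-pos f a fa)

-- Perfect matchings

record PerfectMatching {n} (K : SimpleGraph n) : Set where
  field
    partner      : Fin n → Fin n
    involutive   : ∀ v → partner (partner v) ≡ v
    fixpointFree : ∀ v → ¬ partner v ≡ v
    edge         : ∀ v → adj K v (partner v) ≡ true

record InducedPerfectMatching {n} (K : SimpleGraph n) (C : Fin n → Bool) : Set where
  field
    partner      : Fin n → Fin n
    closed       : ∀ v → C v ≡ true → C (partner v) ≡ true
    involutive   : ∀ v → C v ≡ true → partner (partner v) ≡ v
    fixpointFree : ∀ v → C v ≡ true → ¬ partner v ≡ v
    edge         : ∀ v → C v ≡ true → adj K v (partner v) ≡ true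

adjacent-≢ : ∀ {n} (K : SimpleGraph n) {u v : Fin n} → adj K u v ≡ true → ¬ u ≡ v
adjacent-≢ K {u} uv refl = bool-clash uv (loopless K u)

glue : ∀ {n} {K K′ : SimpleGraph n} {C : Fin n → Bool} →
  InducedPerfectMatching K C → (Q : PerfectMatching K′) →
  (∀ v → C v ≡ true → C (PerfectMatching.partner Q v) ≡ true) →
  (∀ v → C v ≡ false → adj K v (PerfectMatching.partner Q v) ≡ true) →
  PerfectMatching K
glue {n} {K} {C = C} M Q Q-closed Q-edge = record
  { partner = r ; involutive = r-involutive ; fixpointFree = r-fixpointFree ; edge = r-edge }
  where
    module M = InducedPerfectMatching M
    module Q = PerfectMatching Q

    r : Fin n → Fin n
    r v = if C v then M.partner v else Q.partner v

    Q-closed-outside : ∀ v → C v ≡ false → C (Q.partner v) ≡ false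
    Q-closed-outside v Cv = ≢true⇒≡false λ Cqv →
      bool-clash (subst (λ u → C u ≡ true) (Q.involutive v) (Q-closed _ Cqv)) Cv

    r-involutive : ∀ v → r (r v) ≡ v
    r-involutive v with C v in Cv
    ... | true rewrite M.closed v Cv = M.involutive v Cv
    ... | false rewrite Q-closed-outside v Cv = Q.involutive v

    r-fixpointFree : ∀ v → ¬ r v ≡ v
    r-fixpointFree v with C v in Cv
    ... | true = M.fixpointFree v Cv
    ... | false = Q.fixpointFree v

    r-edge : ∀ v → adj K v (r v) ≡ true
    r-edge v with C v in Cv
    ... | true = M.edge v Cv
    ... | false = Q-edge v Cv

isEdge : ∀ {n} → Fin n → Fin n → Fin n → Fin n → Bool
isEdge a b u v = ((u == a) ∧ (v == b)) ∨ ((u == b) ∧ (v == a))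

isEdge-sym : ∀ {n} (a b u v : Fin n) → isEdge a b u v ≡ isEdge a b v u
isEdge-sym a b u v = trans (𝔹.∨-comm ((u == a) ∧ (v == b)) _)
  (cong₂ _∨_ (𝔹.∧-comm (u == b) (v == a)) (𝔹.∧-comm (u == a) (v == b)))

isEdge-irreflexive : ∀ {n} {a b : Fin n} → ¬ a ≡ b → ∀ v → isEdge a b v v ≡ false
isEdge-irreflexive {a = a} {b} a≢b v with v ≟ a | v ≟ b
... | yes refl | yes refl = ⊥-elim (a≢b refl)
... | yes _ | no _ = refl
... | no _ | yes _ = refl
... | no _ | no _ = refl

isEdge-away : ∀ {n} {a b : Fin n} (u v : Fin n) → ¬ u ≡ a → ¬ u ≡ b → isEdge a b u v ≡ false
isEdge-away u v u≢a u≢b rewrite ≢⇒==false u≢a | ≢⇒==false u≢b = refl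

isEdge-ends : ∀ {n} {a b : Fin n} (u v : Fin n) → isEdge a b u v ≡ true → (u ≡ a × v ≡ b) ⊎ (u ≡ b × v ≡ a)
isEdge-ends u v e with ∨-elim _ e
... | inj₁ h = let (u≡a , v≡b) = ∧-elim _ h in inj₁ (==⇒≡ u≡a , ==⇒≡ v≡b)
... | inj₂ h = let (u≡b , v≡a) = ∧-elim _ h in inj₂ (==⇒≡ u≡b , ==⇒≡ v≡a)

addEdge : ∀ {n} (K : SimpleGraph n) (a b : Fin n) → ¬ a ≡ b → SimpleGraph n
addEdge K a b a≢b = record
  { adj = λ u v → adj K u v ∨ isEdge a b u v
  ; sym = λ u v → cong₂ _∨_ (SimpleGraph.sym K u v) (isEdge-sym a b u v)
  ; loopless = λ v → cong₂ _∨_ (loopless K v) (isEdge-irreflexive a≢b v) }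

addEdge-edge : ∀ {n} {K : SimpleGraph n} {a b : Fin n} {a≢b : ¬ a ≡ b} (u v : Fin n) →
  adj (addEdge K a b a≢b) u v ≡ true → isEdge a b u v ≡ false → adj K u v ≡ true
addEdge-edge {K = K} u v e new with adj K u v
... | true = refl
... | false = trans (sym new) e

dropUnusedEdge : ∀ {n} {K : SimpleGraph n} {a b : Fin n} {a≢b : ¬ a ≡ b}
  (P : PerfectMatching (addEdge K a b a≢b)) → ¬ PerfectMatching.partner P a ≡ b → PerfectMatching K
dropUnusedEdge {K = K} {a = a} {b} {a≢b} P pa≢b = record
  { partner = partner ; involutive = involutive ; fixpointFree = fixpointFree
  ; edge = λ v → addEdge-edge {K = K} {a≢b = a≢b} v (partner v) (edge v) (unused v) }
  where
    open PerfectMatching P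
    unused : ∀ v → isEdge a b v (partner v) ≡ false
    unused v = ≢true⇒≡false λ e → case (isEdge-ends v (partner v) e)
      where
        case : (v ≡ a × partner v ≡ b) ⊎ (v ≡ b × partner v ≡ a) → ⊥
        case (inj₁ (refl , pa≡b)) = pa≢b pa≡b
        case (inj₂ (refl , pb≡a)) = pa≢b (trans (cong partner (sym pb≡a)) (involutive b))

anyBelow : ℕ → (ℕ → Bool) → Bool
anyBelow zero f = false
anyBelow (suc N) f = f N ∨ anyBelow N f

anyBelow-intro : ∀ {N} (f : ℕ → Bool) k → k < N → f k ≡ true → anyBelow N f ≡ true
anyBelow-intro {suc N} f k k<1+N fk with m≤n⇒m<n∨m≡n (≤-pred k<1+N)
... | inj₁ k<N = ∨-introʳ (f N) (anyBelow-intro f k k<N fk)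
... | inj₂ refl rewrite fk = refl

anyBelow-elim : ∀ {N} (f : ℕ → Bool) → anyBelow N f ≡ true → ∃ λ k → k < N × f k ≡ true
anyBelow-elim {suc N} f h with ∨-elim (f N) h
... | inj₁ fN = N , ≤-refl , fN
... | inj₂ below with anyBelow-elim f below
... | k , k<N , fk = k , m≤n⇒m≤1+n k<N , fk

firstOrNone : (f : ℕ → Bool) (N : ℕ) →
  (∃ λ m → f m ≡ true × (∀ k → k < m → f k ≡ false)) ⊎ (∀ k → k < N → f k ≡ false)
firstOrNone f zero = inj₂ λ _ ()
firstOrNone f (suc N) with firstOrNone f N | f N in fN
... | inj₁ first | _ = inj₁ first
... | inj₂ none | true = inj₁ (N , fN , none)
... | inj₂ none | false = inj₂ λ k k<1+N → case (m≤n⇒m<n∨m≡n (≤-pred k<1+N))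
  where
    case : ∀ {k} → k < N ⊎ k ≡ N → f k ≡ false
    case (inj₁ k<N) = none _ k<N
    case (inj₂ refl) = fN

pairUp : ∀ {n} → Fin n → Fin n → (Fin n → Fin n) → Fin n → Fin n
pairUp a b f v = if v == a then b else if v == b then a else f v

module _ {n} {a b : Fin n} (f : Fin n → Fin n) where

  pairUp-a : ∀ {v} → v ≡ a → pairUp a b f v ≡ b
  pairUp-a refl rewrite ==-refl a = refl

  pairUp-b : ¬ a ≡ b → ∀ {v} → v ≡ b → pairUp a b f v ≡ a
  pairUp-b a≢b refl rewrite ≢⇒==false (a≢b ∘ sym) | ==-refl b = refl

  pairUp-other : ∀ {v} → ¬ v ≡ a → ¬ v ≡ b → pairUp a b f v ≡ f v
  pairUp-other v≢a v≢b rewrite ≢⇒==false v≢a | ≢⇒==false v≢b = refl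

data Trichotomy {n} (a b v : Fin n) : Set where
  is-a  : v ≡ a → Trichotomy a b v
  is-b  : v ≡ b → Trichotomy a b v
  other : ¬ v ≡ a → ¬ v ≡ b → Trichotomy a b v

trichotomy : ∀ {n} (a b v : Fin n) → Trichotomy a b v
trichotomy a b v with v ≟ a | v ≟ b
... | yes v≡a | _ = is-a v≡a
... | no _ | yes v≡b = is-b v≡b
... | no v≢a | no v≢b = other v≢a v≢b

InducedPerfectMatching-cong : ∀ {n} {K : SimpleGraph n} {C D : Fin n → Bool} → (∀ v → C v ≡ D v) →
  InducedPerfectMatching K C → InducedPerfectMatching K D
InducedPerfectMatching-cong {C = C} {D} C≗D M = record
  { partner = partner
  ; closed = λ v Dv → trans (sym (C≗D (partner v))) (closed v (back Dv))
  ; involutive = λ v → involutive v ∘ back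
  ; fixpointFree = λ v → fixpointFree v ∘ back
  ; edge = λ v → edge v ∘ back }
  where
    open InducedPerfectMatching M
    back : ∀ {v} → D v ≡ true → C v ≡ true
    back {v} Dv = trans (C≗D v) Dv

addMatchedEdge : ∀ {n} {K : SimpleGraph n} {C : Fin n → Bool} {a b : Fin n} →
  InducedPerfectMatching K (remove b (remove a C)) → C a ≡ true → C b ≡ true → adj K a b ≡ true →
  InducedPerfectMatching K C
addMatchedEdge {n} {K} {C} {a} {b} M Ca Cb ab = record
  { partner = m′ ; closed = closed ; involutive = involutive ; fixpointFree = fixpointFree ; edge = edge }
  where
    module M = InducedPerfectMatching M
    m m′ : Fin n → Fin n
    m = M.partner
    m′ = pairUp a b m
    a≢b : ¬ a ≡ b
    a≢b = adjacent-≢ K ab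

    inner : ∀ {v} → C v ≡ true → ¬ v ≡ a → ¬ v ≡ b → remove b (remove a C) v ≡ true
    inner {v} Cv v≢a v≢b = remove-intro (remove a C) v (remove-intro C v Cv v≢a) v≢b

    inner-elim : ∀ {v} → remove b (remove a C) v ≡ true → C v ≡ true × ¬ v ≡ a × ¬ v ≡ b
    inner-elim {v} h with remove-elim (remove a C) v h
    ... | h′ , v≢b with remove-elim C v h′
    ...   | Cv , v≢a = Cv , v≢a , v≢b

    closed : ∀ v → C v ≡ true → C (m′ v) ≡ true
    closed v Cv with trichotomy a b v
    ... | is-a e = subst (λ u → C u ≡ true) (sym (pairUp-a m e)) Cb
    ... | is-b e = subst (λ u → C u ≡ true) (sym (pairUp-b m a≢b e)) Ca
    ... | other v≢a v≢b rewrite pairUp-other m v≢a v≢b = proj₁ (inner-elim (M.closed v (inner Cv v≢a v≢b)))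

    involutive : ∀ v → C v ≡ true → m′ (m′ v) ≡ v
    involutive v Cv with trichotomy a b v
    ... | is-a e = trans (cong m′ (pairUp-a m e)) (trans (pairUp-b m a≢b refl) (sym e))
    ... | is-b e = trans (cong m′ (pairUp-b m a≢b e)) (trans (pairUp-a {a = a} {b = b} m refl) (sym e))
    ... | other v≢a v≢b with inner-elim (M.closed v (inner Cv v≢a v≢b))
    ...   | _ , mv≢a , mv≢b rewrite pairUp-other m v≢a v≢b | pairUp-other m mv≢a mv≢b =
      M.involutive v (inner Cv v≢a v≢b)

    fixpointFree : ∀ v → C v ≡ true → ¬ m′ v ≡ v
    fixpointFree v Cv with trichotomy a b v
    ... | is-a e = λ m′v≡v → a≢b (sym (trans (sym (pairUp-a m e)) (trans m′v≡v e)))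
    ... | is-b e = λ m′v≡v → a≢b (trans (sym (pairUp-b m a≢b e)) (trans m′v≡v e))
    ... | other v≢a v≢b rewrite pairUp-other m v≢a v≢b = M.fixpointFree v (inner Cv v≢a v≢b)

    edge : ∀ v → C v ≡ true → adj K v (m′ v) ≡ true
    edge v Cv with trichotomy a b v
    ... | is-a e = subst₂ (λ u u′ → adj K u u′ ≡ true) (sym e) (sym (pairUp-a m e)) ab
    ... | is-b e = subst₂ (λ u u′ → adj K u u′ ≡ true) (sym e) (sym (pairUp-b m a≢b e))
                          (trans (SimpleGraph.sym K b a) ab)
    ... | other v≢a v≢b rewrite pairUp-other m v≢a v≢b = M.edge v (inner Cv v≢a v≢b)

-- Switching along an alternating walk

module Switching {n} (K : SimpleGraph n) {x y z w : Fin n} {x≢z : ¬ x ≡ z} {y≢w : ¬ y ≡ w}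
  (xy : adj K x y ≡ true) (yz : adj K y z ≡ true)
  (P : PerfectMatching (addEdge K x z x≢z)) (Q : PerfectMatching (addEdge K y w y≢w))
  (px : PerfectMatching.partner P x ≡ z) (qy : PerfectMatching.partner Q y ≡ w) where

  open PerfectMatching P using () renaming
    (partner to p; involutive to p-involutive; fixpointFree to p-fixpointFree; edge to p-edge)
  open PerfectMatching Q using () renaming
    (partner to q; involutive to q-involutive; fixpointFree to q-fixpointFree; edge to q-edge)

  onXZ : Fin n → Bool
  onXZ v = (v == x) ∨ (v == z)

  onXZ-cases : ∀ v → onXZ v ≡ true → v ≡ x ⊎ v ≡ z
  onXZ-cases v h with ∨-elim (v == x) h
  ... | inj₁ e = inj₁ (==⇒≡ e)
  ... | inj₂ e = inj₂ (==⇒≡ e)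

  offXZ-≢x : ∀ {v} → onXZ v ≡ false → ¬ v ≡ x
  offXZ-≢x off refl rewrite ==-refl x = bool-clash refl off

  offXZ-≢z : ∀ {v} → onXZ v ≡ false → ¬ v ≡ z
  offXZ-≢z {v} off refl rewrite ==-refl z = bool-clash (𝔹.∨-zeroʳ (v == x)) off

  offXZ-≢onXZ : ∀ {u v} → onXZ u ≡ false → onXZ v ≡ true → ¬ u ≡ v
  offXZ-≢onXZ off on refl = bool-clash on off

  y-offXZ : onXZ y ≡ false
  y-offXZ = ≢true⇒≡false λ h → case (onXZ-cases y h)
    where
      case : y ≡ x ⊎ y ≡ z → ⊥
      case (inj₁ refl) = bool-clash xy (loopless K y)
      case (inj₂ refl) = bool-clash yz (loopless K y)

  p-onXZ : ∀ v → onXZ v ≡ true → onXZ (p v) ≡ true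
  p-onXZ v h with onXZ-cases v h
  ... | inj₁ refl rewrite px | ==-refl z = 𝔹.∨-zeroʳ (z == x)
  ... | inj₂ refl rewrite trans (cong p (sym px)) (p-involutive x) | ==-refl x = refl

  p-offXZ : ∀ v → onXZ v ≡ false → onXZ (p v) ≡ false
  p-offXZ v off = ≢true⇒≡false λ h →
    bool-clash (subst (λ u → onXZ u ≡ true) (p-involutive v) (p-onXZ (p v) h)) off

  p-edge-K : ∀ v → onXZ v ≡ false → adj K v (p v) ≡ true
  p-edge-K v off = addEdge-edge {K = K} {a≢b = x≢z} v (p v) (p-edge v)
    (isEdge-away v (p v) (offXZ-≢x off) (offXZ-≢z off))

  q-edge-K : ∀ v → ¬ v ≡ y → ¬ v ≡ w → adj K v (q v) ≡ true
  q-edge-K v v≢y v≢w = addEdge-edge {K = K} {a≢b = y≢w} v (q v) (q-edge v) (isEdge-away v (q v) v≢y v≢w)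

  -- The alternating walk y = walk₀ 0, walk₁ 0 = w, walk₀ 1, walk₁ 1, … starting with the
  -- Q-edge yw: Q pairs walk₀ k with walk₁ k, and P pairs walk₁ k with walk₀ (suc k).

  σ : Fin n → Fin n
  σ v = p (q v)

  walk₀ walk₁ : ℕ → Fin n
  walk₀ k = fold y σ k
  walk₁ k = q (walk₀ k)

  σ-injective : ∀ {a b} → σ a ≡ σ b → a ≡ b
  σ-injective {a} {b} e = begin
    a              ≡⟨ sym (q-involutive a) ⟩
    q (q a)        ≡⟨ cong q (sym (p-involutive (q a))) ⟩
    q (p (σ a))    ≡⟨ cong (q ∘ p) e ⟩
    q (p (σ b))    ≡⟨ cong q (p-involutive (q b)) ⟩
    q (q b)        ≡⟨ q-involutive b ⟩
    b              ∎
    where open ≡-Reasoning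

  σ^-injective : ∀ k {a b} → fold a σ k ≡ fold b σ k → a ≡ b
  σ^-injective zero e = e
  σ^-injective (suc k) e = σ^-injective k (σ-injective e)

  -- Alternating closed walks have even length.
  σ^-≢q : ∀ k u → ¬ fold u σ k ≡ q u
  σ^-≢q zero u e = q-fixpointFree u (sym e)
  σ^-≢q (suc zero) u e = p-fixpointFree (q u) e
  σ^-≢q (suc (suc k)) u e = σ^-≢q k (σ u) (begin
    fold (σ u) σ k                   ≡⟨ shift k ⟨
    fold u σ (suc k)                 ≡⟨ q-involutive _ ⟨
    q (q (fold u σ (suc k)))         ≡⟨ cong q (p-involutive _) ⟨
    q (p (fold u σ (suc (suc k))))   ≡⟨ cong (q ∘ p) e ⟩
    q (σ u)                          ∎)
    where
      open ≡-Reasoning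
      shift : ∀ k → fold u σ (suc k) ≡ fold (σ u) σ k
      shift k = trans (iterate-is-fold u σ (suc k)) (sym (iterate-is-fold (σ u) σ k))

  walk₁≢y : ∀ k → ¬ walk₁ k ≡ y
  walk₁≢y k e = σ^-≢q k y (trans (sym (q-involutive (walk₀ k))) (cong q e))

  walk-returns : ∃ λ N → walk₀ (suc N) ≡ y
  walk-returns with FinP.pigeonhole (n<1+n n) (walk₀ ∘ toℕ)
  ... | i , j , i<j , same = N , sym (σ^-injective (toℕ i) (begin
    fold y σ (toℕ i)                     ≡⟨ same ⟩
    fold y σ (toℕ j)                     ≡⟨ cong (fold y σ) (sym (m+[n∸m]≡n i<j)) ⟩
    fold y σ (suc (toℕ i) + N)           ≡⟨ cong (fold y σ) (+-suc (toℕ i) N) ⟨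
    fold y σ (toℕ i + suc N)             ≡⟨ fold-+ y σ (toℕ i) ⟩
    fold (walk₀ (suc N)) σ (toℕ i)       ∎))
    where
      open ≡-Reasoning
      N : ℕ
      N = toℕ j ∸ suc (toℕ i)

  offXZ-walk₀ : ∀ {m} → (∀ k → k < m → onXZ (walk₁ k) ≡ false) →
    ∀ k → k ≤ m → onXZ (walk₀ k) ≡ false
  offXZ-walk₀ before zero _ = y-offXZ
  offXZ-walk₀ before (suc k) k<m = p-offXZ (walk₁ k) (before k k<m)

  onPrefix : ℕ → Fin n → Bool
  onPrefix N v = anyBelow N λ k → (v == walk₀ k) ∨ (v == walk₁ k)

  onPrefix-walk₀ : ∀ {N} k → k < N → onPrefix N (walk₀ k) ≡ true
  onPrefix-walk₀ k k<N = anyBelow-intro _ k k<N (∨-introˡ _ (==-refl (walk₀ k)))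

  onPrefix-walk₁ : ∀ {N} k → k < N → onPrefix N (walk₁ k) ≡ true
  onPrefix-walk₁ k k<N = anyBelow-intro _ k k<N (∨-introʳ _ (==-refl (walk₁ k)))

  data PrefixVertex (N : ℕ) (v : Fin n) : Set where
    at₀ : ∀ k → k < N → v ≡ walk₀ k → PrefixVertex N v
    at₁ : ∀ k → k < N → v ≡ walk₁ k → PrefixVertex N v

  onPrefix-elim : ∀ N v → onPrefix N v ≡ true → PrefixVertex N v
  onPrefix-elim N v h with anyBelow-elim _ h
  ... | k , k<N , e with ∨-elim (v == walk₀ k) e
  ... | inj₁ e₀ = at₀ k k<N (==⇒≡ e₀)
  ... | inj₂ e₁ = at₁ k k<N (==⇒≡ e₁)

  onPrefix-q : ∀ N v → onPrefix N v ≡ true → onPrefix N (q v) ≡ true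
  onPrefix-q N v h with onPrefix-elim N v h
  ... | at₀ k k<N refl = onPrefix-walk₁ k k<N
  ... | at₁ k k<N refl rewrite q-involutive (walk₀ k) = onPrefix-walk₀ k k<N

  q-edge-offPrefix : ∀ N → 0 < N → ∀ v → onPrefix N v ≡ false → adj K v (q v) ≡ true
  q-edge-offPrefix N 0<N v off = q-edge-K v
    (λ { refl → bool-clash (onPrefix-walk₀ 0 0<N) off })
    (λ { refl → bool-clash (subst (λ u → onPrefix N u ≡ true) qy (onPrefix-walk₁ 0 0<N)) off })

  -- The walk closes up at y without meeting x or z: use P on the cycle and Q elsewhere.
  module Closing (N : ℕ) (period : walk₀ (suc N) ≡ y)
    (avoids : ∀ k → k < suc N → onXZ (walk₁ k) ≡ false) where

    onCycle : Fin n → Bool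
    onCycle = onPrefix (suc N)

    onCycle-p : ∀ v → onCycle v ≡ true → onCycle (p v) ≡ true
    onCycle-p v h with onPrefix-elim (suc N) v h
    ... | at₀ zero _ refl = subst (λ u → onCycle u ≡ true) p-y (onPrefix-walk₁ N ≤-refl)
      where
        p-y : walk₁ N ≡ p y
        p-y = trans (sym (p-involutive (walk₁ N))) (cong p period)
    ... | at₀ (suc k) k<N refl rewrite p-involutive (walk₁ k) = onPrefix-walk₁ k (m≤n⇒m≤1+n (≤-pred k<N))
    ... | at₁ k k<N refl with m≤n⇒m<n∨m≡n (≤-pred k<N)
    ...   | inj₁ k<N′ = onPrefix-walk₀ (suc k) (s≤s k<N′)
    ...   | inj₂ refl = subst (λ u → onCycle u ≡ true) (sym period) (onPrefix-walk₀ {suc N} 0 (s≤s z≤n))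

    onCycle-offXZ : ∀ v → onCycle v ≡ true → onXZ v ≡ false
    onCycle-offXZ v h with onPrefix-elim (suc N) v h
    ... | at₀ k k<N refl = offXZ-walk₀ (λ j j<k → avoids j (<-≤-trans j<k (<⇒≤ k<N))) k ≤-refl
    ... | at₁ k k<N refl = avoids k k<N

    cycleMatching : InducedPerfectMatching K onCycle
    cycleMatching = record
      { partner = p ; closed = onCycle-p
      ; involutive = λ v _ → p-involutive v ; fixpointFree = λ v _ → p-fixpointFree v
      ; edge = λ v h → p-edge-K v (onCycle-offXZ v h) }

    result : PerfectMatching K
    result = glue cycleMatching Q (onPrefix-q (suc N)) (q-edge-offPrefix (suc N) (s≤s z≤n))

  -- The walk first meets {x, z} at h = walk₁ m: match y with h, use P inside the path and Q elsewhere.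
  module Hitting (m : ℕ) (hits : onXZ (walk₁ m) ≡ true)
    (before : ∀ k → k < m → onXZ (walk₁ k) ≡ false) where

    h : Fin n
    h = walk₁ m

    yh : adj K y h ≡ true
    yh with onXZ-cases h hits
    ... | inj₁ h≡x = subst (λ u → adj K y u ≡ true) (sym h≡x) (trans (SimpleGraph.sym K y x) xy)
    ... | inj₂ h≡z = subst (λ u → adj K y u ≡ true) (sym h≡z) yz

    onPath : Fin n → Bool
    onPath = onPrefix (suc m)

    -- If the walk returned to y at step j ≤ m, it would have met {x, z} already at step m ∸ j.
    walk₀≢y : ∀ j → 0 < j → j ≤ m → ¬ walk₀ j ≡ y
    walk₀≢y j 0<j j≤m e =
      bool-clash (subst (λ u → onXZ (q u) ≡ true) earlier hits) (before (m ∸ j) (∸-monoʳ-< 0<j j≤m))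
      where
        earlier : walk₀ m ≡ walk₀ (m ∸ j)
        earlier = begin
          fold y σ m                      ≡⟨ cong (fold y σ) (m∸n+n≡m j≤m) ⟨
          fold y σ (m ∸ j + j)            ≡⟨ fold-+ y σ (m ∸ j) ⟩
          fold (walk₀ j) σ (m ∸ j)        ≡⟨ cong (λ u → fold u σ (m ∸ j)) e ⟩
          fold y σ (m ∸ j)                ∎
          where open ≡-Reasoning

    interior : ∀ v → onPath v ≡ true → ¬ v ≡ y → ¬ v ≡ h →
      onXZ v ≡ false × onPath (p v) ≡ true × ¬ p v ≡ y × ¬ p v ≡ h
    interior v on v≢y v≢h with onPrefix-elim (suc m) v on
    ... | at₀ zero _ refl = ⊥-elim (v≢y refl)
    ... | at₀ (suc k) k<m refl rewrite p-involutive (walk₁ k) =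
      offXZ-walk₀ before (suc k) (≤-pred k<m) ,
      onPrefix-walk₁ k (m≤n⇒m≤1+n (≤-pred k<m)) ,
      walk₁≢y k ,
      offXZ-≢onXZ (before k (≤-pred k<m)) hits
    ... | at₁ k k≤m refl with m≤n⇒m<n∨m≡n (≤-pred k≤m)
    ...   | inj₂ refl = ⊥-elim (v≢h refl)
    ...   | inj₁ k<m =
      before k k<m ,
      onPrefix-walk₀ (suc k) (s≤s k<m) ,
      walk₀≢y (suc k) (s≤s z≤n) k<m ,
      offXZ-≢onXZ (offXZ-walk₀ before (suc k) k<m) hits

    interiorMatching : InducedPerfectMatching K (remove h (remove y onPath))
    interiorMatching = record
      { partner = p ; closed = closed
      ; involutive = λ v _ → p-involutive v ; fixpointFree = λ v _ → p-fixpointFree v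
      ; edge = λ v inside → p-edge-K v (proj₁ (interior′ v inside)) }
      where
        interior′ : ∀ v → remove h (remove y onPath) v ≡ true →
          onXZ v ≡ false × onPath (p v) ≡ true × ¬ p v ≡ y × ¬ p v ≡ h
        interior′ v inside with remove-elim (remove y onPath) v inside
        ... | inside′ , v≢h with remove-elim onPath v inside′
        ...   | on , v≢y = interior v on v≢y v≢h
        closed : ∀ v → remove h (remove y onPath) v ≡ true → remove h (remove y onPath) (p v) ≡ true
        closed v inside with interior′ v inside
        ... | _ , on , pv≢y , pv≢h = remove-intro (remove y onPath) (p v) (remove-intro onPath (p v) on pv≢y) pv≢h

    pathMatching : InducedPerfectMatching K onPath
    pathMatching = addMatchedEdge interiorMatching (onPrefix-walk₀ {suc m} 0 (s≤s z≤n)) (onPrefix-walk₁ m ≤-refl) yh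

    result : PerfectMatching K
    result = glue pathMatching Q (onPrefix-q (suc m)) (q-edge-offPrefix (suc m) (s≤s z≤n))

  result : PerfectMatching K
  result with walk-returns
  ... | N , period with firstOrNone (onXZ ∘ walk₁) (suc N)
  ... | inj₁ (m , hits , before) = Hitting.result m hits before
  ... | inj₂ avoids = Closing.result N period avoids

switch : ∀ {n} (K : SimpleGraph n) {x y z w : Fin n} (x≢z : ¬ x ≡ z) (y≢w : ¬ y ≡ w) →
  adj K x y ≡ true → adj K y z ≡ true →
  PerfectMatching (addEdge K x z x≢z) → PerfectMatching (addEdge K y w y≢w) → PerfectMatching K
switch K {x} {y} {z} {w} _ _ xy yz P Q
  with PerfectMatching.partner P x ≟ z | PerfectMatching.partner Q y ≟ w
... | no px≢z | _ = dropUnusedEdge P px≢z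
... | yes _ | no qy≢w = dropUnusedEdge Q qy≢w
... | yes px | yes qy = Switching.result K xy yz P Q px qy

parity-even : ∀ {m} → 2 ∣ m → parity m ≡ 0ℙ
parity-even (divides q refl) = trans (ℙ.*-homo-* q 2) (ℙ.*-zeroʳ (parity q))

parity-double : ∀ a m → parity (a + (a + m)) ≡ parity m
parity-double a m = begin
  parity (a + (a + m))                 ≡⟨ ℙ.+-homo-+ a (a + m) ⟩
  parity a ⊕ parity (a + m)            ≡⟨ cong (parity a ⊕_) (ℙ.+-homo-+ a m) ⟩
  parity a ⊕ (parity a ⊕ parity m)     ≡⟨ ℙ.+-assoc (parity a) (parity a) (parity m) ⟨
  (parity a ⊕ parity a) ⊕ parity m     ≡⟨ cong (_⊕ parity m) (ℙ.p+p≡0ℙ (parity a)) ⟩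
  parity m                             ∎
  where open ≡-Reasoning

even-pos⇒≥2 : ∀ {m} → parity m ≡ 0ℙ → 1 ≤ m → 2 ≤ m
even-pos⇒≥2 {suc zero} () _
even-pos⇒≥2 {suc (suc _)} _ _ = s≤s (s≤s z≤n)

handshake : ∀ {n} (M : Fin n → Fin n → Bool) → (∀ u v → M u v ≡ M v u) → (∀ v → M v v ≡ false) →
  parity (sum λ v → countTrue (M v)) ≡ 0ℙ
handshake {zero} M _ _ = refl
handshake {suc n} M M-sym M-loopless = begin
  parity (sum λ v → countTrue (M v))   ≡⟨ cong parity degrees ⟩
  parity (A + (A + rest))              ≡⟨ parity-double A rest ⟩
  parity rest
    ≡⟨ handshake (λ u v → M (fsuc u) (fsuc v)) (λ u v → M-sym (fsuc u) (fsuc v)) (M-loopless ∘ fsuc) ⟩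
  0ℙ                                   ∎
  where
    open ≡-Reasoning
    A rest : ℕ
    A = countTrue (λ w → M fzero (fsuc w))
    rest = sum λ v → countTrue (λ w → M (fsuc v) (fsuc w))
    column : sum (λ v → 𝟙 (M (fsuc v) fzero)) ≡ A
    column = trans (sum-cong-≗ λ v → cong 𝟙 (M-sym (fsuc v) fzero)) (sym (countTrue≡sum (λ w → M fzero (fsuc w))))
    degrees : sum (λ v → countTrue (M v)) ≡ A + (A + rest)
    degrees rewrite M-loopless fzero =
      cong (A +_) (trans (∑-distrib-+ (λ v → 𝟙 (M (fsuc v) fzero)) _) (cong (_+ rest) column))


sum-mono-≤ : ∀ {n} {f g : Fin n → ℕ} → (∀ i → f i ≤ g i) → sum f ≤ sum g
sum-mono-≤ {zero} _ = z≤n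
sum-mono-≤ {suc n} f≤g = +-mono-≤ (f≤g fzero) (sum-mono-≤ (f≤g ∘ fsuc))

sum-zero : ∀ {n} {f : Fin n → ℕ} → (∀ i → f i ≡ 0) → sum f ≡ 0
sum-zero {zero} _ = refl
sum-zero {suc n} f≡0 rewrite f≡0 fzero = sum-zero (f≡0 ∘ fsuc)

sumOver : ∀ {n} → (Fin n → Bool) → (Fin n → ℕ) → ℕ
sumOver C g = sum λ v → if C v then g v else 0

module _ {n} (C : Fin n → Bool) where

  sumOver-cong : ∀ {f g : Fin n → ℕ} → (∀ v → C v ≡ true → f v ≡ g v) → sumOver C f ≡ sumOver C g
  sumOver-cong f≗g = sum-cong-≗ λ v → pointwise v (C v) refl
    where
      pointwise : ∀ v b → C v ≡ b → (if b then _ else 0) ≡ (if b then _ else 0)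
      pointwise v true Cv = f≗g v Cv
      pointwise v false _ = refl

  sumOver-mono : ∀ {f g : Fin n → ℕ} → (∀ v → C v ≡ true → f v ≤ g v) → sumOver C f ≤ sumOver C g
  sumOver-mono f≤g = sum-mono-≤ λ v → pointwise v (C v) refl
    where
      pointwise : ∀ v b → C v ≡ b → (if b then _ else 0) ≤ (if b then _ else 0)
      pointwise v true Cv = f≤g v Cv
      pointwise v false _ = z≤n

  sumOver-+ : ∀ (f g : Fin n → ℕ) → sumOver C (λ v → f v + g v) ≡ sumOver C f + sumOver C g
  sumOver-+ f g = trans (sum-cong-≗ λ v → pointwise (C v))
    (∑-distrib-+ (λ v → if C v then f v else 0) (λ v → if C v then g v else 0))
    where
      pointwise : ∀ {v} b → (if b then f v + g v else 0) ≡ (if b then f v else 0) + (if b then g v else 0)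
      pointwise true = refl
      pointwise false = refl

  sumOver-const : ∀ {g : Fin n → ℕ} c → (∀ v → C v ≡ true → g v ≡ c) → sumOver C g ≡ c * countTrue C
  sumOver-const {g} c g≡c = begin
    sumOver C g              ≡⟨ sum-cong-≗ (λ v → pointwise v (C v) refl) ⟩
    sum (λ v → c * 𝟙 (C v))  ≡⟨ *-distribˡ-sum c (𝟙 ∘ C) ⟨
    c * sum (𝟙 ∘ C)          ≡⟨ cong (c *_) (countTrue≡sum C) ⟨
    c * countTrue C          ∎
    where
      open ≡-Reasoning
      pointwise : ∀ v b → C v ≡ b → (if b then g v else 0) ≡ c * 𝟙 b
      pointwise v true Cv = trans (g≡c v Cv) (sym (*-identityʳ c))
      pointwise v false _ = sym (*-zeroʳ c)

  sumOver-one : sumOver C (λ _ → 1) ≡ countTrue C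
  sumOver-one = trans (sumOver-const 1 λ _ _ → refl) (+-identityʳ _)

  sumOver-countTrue : ∀ (f : Fin n → Fin n → Bool) →
    sumOver C (λ v → countTrue (f v)) ≡ sum λ v → countTrue (λ w → C v ∧ f v w)
  sumOver-countTrue f = sum-cong-≗ λ v → pointwise v (C v)
    where
      pointwise : ∀ v b → (if b then countTrue (f v) else 0) ≡ countTrue (λ w → b ∧ f v w)
      pointwise v true = refl
      pointwise v false = sym (countTrue-false {n} {λ _ → false} λ _ → refl)

sumOver-⊆ : ∀ {n} {C D : Fin n → Bool} (g : Fin n → ℕ) → (∀ v → C v ≡ true → D v ≡ true) →
  sumOver C g ≤ sumOver D g
sumOver-⊆ {C = C} {D} g C⊆D = sum-mono-≤ λ v → pointwise v (C v) refl
  where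
    pointwise : ∀ v b → C v ≡ b → (if b then g v else 0) ≤ (if D v then g v else 0)
    pointwise v true Cv rewrite C⊆D v Cv = ≤-refl
    pointwise v false _ = z≤n

sumOver-split : ∀ {n} (C D : Fin n → Bool) (g : Fin n → ℕ) →
  sumOver C g ≡ sumOver (λ v → C v ∧ D v) g + sumOver (λ v → C v ∧ not (D v)) g
sumOver-split C D g = trans (sum-cong-≗ λ v → pointwise v (C v) (D v))
  (∑-distrib-+ (λ v → if C v ∧ D v then g v else 0) (λ v → if C v ∧ not (D v) then g v else 0))
  where
    pointwise : ∀ v c e → (if c then g v else 0) ≡ (if c ∧ e then g v else 0) + (if c ∧ not e then g v else 0)
    pointwise v true true = sym (+-identityʳ (g v))
    pointwise v true false = refl
    pointwise v false _ = refl

double-count : ∀ {n} (A B : Fin n → Bool) (M : Fin n → Fin n → Bool) →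
  sumOver A (λ v → countTrue (λ w → M v w ∧ B w)) ≡ sumOver B (λ w → countTrue (λ v → A v ∧ M v w))
double-count A B M = begin
  sumOver A (λ v → countTrue (λ w → M v w ∧ B w))
    ≡⟨ sumOver-countTrue A _ ⟩
  sum (λ v → countTrue (λ w → A v ∧ (M v w ∧ B w)))
    ≡⟨ sum-cong-≗ (λ v → trans (countTrue≡sum (λ w → A v ∧ (M v w ∧ B w)))
                                (sum-cong-≗ λ w → cong 𝟙 (rearrange (A v) (M v w) (B w)))) ⟩
  sum (λ v → sum (λ w → 𝟙 (B w ∧ (A v ∧ M v w))))
    ≡⟨ ∑-comm (λ v w → 𝟙 (B w ∧ (A v ∧ M v w))) ⟩
  sum (λ w → sum (λ v → 𝟙 (B w ∧ (A v ∧ M v w))))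
    ≡⟨ sum-cong-≗ (λ w → sym (countTrue≡sum (λ v → B w ∧ (A v ∧ M v w)))) ⟩
  sum (λ w → countTrue (λ v → B w ∧ (A v ∧ M v w)))
    ≡⟨ sumOver-countTrue B _ ⟨
  sumOver B (λ w → countTrue (λ v → A v ∧ M v w)) ∎
  where
    open ≡-Reasoning
    rearrange : ∀ a m b → (a ∧ (m ∧ b)) ≡ (b ∧ (a ∧ m))
    rearrange a m b = trans (sym (𝔹.∧-assoc a m b)) (𝔹.∧-comm (a ∧ m) b)

sumOver-disjoint : ∀ {n} (P R : Fin n → Bool) (F : Fin n → Fin n → Bool) (g : Fin n → ℕ) →
  (∀ u v → P u ≡ true → F u v ≡ true → R v ≡ true) →
  (∀ u u′ v → P u ≡ true → P u′ ≡ true → F u v ≡ true → F u′ v ≡ true → u ≡ u′) →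
  sumOver P (λ u → sumOver (F u) g) ≤ sumOver R g
sumOver-disjoint {n} P R F g inside disjoint = begin
  sumOver P (λ u → sumOver (F u) g)
    ≡⟨ sum-cong-≗ (λ u → distribute u (P u)) ⟩
  sum (λ u → sum (λ v → if P u ∧ F u v then g v else 0))
    ≡⟨ ∑-comm (λ u v → if P u ∧ F u v then g v else 0) ⟩
  sum (λ v → sum (λ u → if P u ∧ F u v then g v else 0))
    ≡⟨ sum-cong-≗ (λ v → sumOver-const (λ u → P u ∧ F u v) (g v) λ _ _ → refl) ⟩
  sum (λ v → g v * countTrue (λ u → P u ∧ F u v))
    ≤⟨ sum-mono-≤ (λ v → at-most-once v (R v) refl) ⟩
  sumOver R g ∎
  where
    open ≤-Reasoning
    distribute : ∀ u b → (if b then sumOver (F u) g else 0) ≡ sum (λ v → if b ∧ F u v then g v else 0)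
    distribute u true = refl
    distribute u false = sym (sum-zero {n} {λ v → if false ∧ F u v then g v else 0} λ _ → refl)
    at-most-once : ∀ v b → R v ≡ b → g v * countTrue (λ u → P u ∧ F u v) ≤ (if b then g v else 0)
    at-most-once v true _ = subst (g v * _ ≤_) (*-identityʳ (g v)) (*-monoʳ-≤ (g v)
      (countTrue-subsingleton _ λ u u′ h h′ →
        let (Pu , Fuv) = ∧-elim (P u) h ; (Pu′ , Fu′v) = ∧-elim (P u′) h′ in disjoint u u′ v Pu Pu′ Fuv Fu′v))
    at-most-once v false Rv = ≤-reflexive (trans (cong (g v *_) (countTrue-false nowhere)) (*-zeroʳ (g v)))
      where
        nowhere : ∀ u → (P u ∧ F u v) ≡ false
        nowhere u = ≢true⇒≡false λ h → let (Pu , Fuv) = ∧-elim (P u) h in bool-clash (inside u v Pu Fuv) Rv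

-- Greedy matching

extendMatching : ∀ {n} {K : SimpleGraph n} {C : Fin n → Bool} → InducedPerfectMatching K C →
  ∀ {x y} → C x ≡ false → C y ≡ false → adj K x y ≡ true → InducedPerfectMatching K (insert y (insert x C))
extendMatching {n} {K} {C} M {x} {y} Cx Cy xy =
  addMatchedEdge (InducedPerfectMatching-cong same M) (∨-introˡ (x == y) (insert-self x C)) (insert-self y (insert x C)) xy
  where
    C′ : Fin n → Bool
    C′ = insert y (insert x C)
    same : ∀ v → C v ≡ remove y (remove x C′) v
    same v with trichotomy x y v
    ... | is-a refl = trans Cx (sym (trans (remove-other (remove x C′) (adjacent-≢ K xy)) (remove-self x C′)))
    ... | is-b refl = trans Cy (sym (remove-self y (remove x C′)))
    ... | other v≢x v≢y = sym (begin
      remove y (remove x C′) v   ≡⟨ remove-other (remove x C′) v≢y ⟩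
      remove x C′ v              ≡⟨ remove-other C′ v≢x ⟩
      insert y (insert x C) v    ≡⟨ insert-other (insert x C) v≢y ⟩
      insert x C v               ≡⟨ insert-other C v≢x ⟩
      C v                        ∎)
      where open ≡-Reasoning

module Greedy {n} (K : SimpleGraph n) where

  record State (X : Fin n → Bool) : Set where
    field
      matched pending : Fin n → Bool
      matching        : InducedPerfectMatching K matched
      disjoint        : ∀ v → matched v ≡ true → pending v ≡ false
      covers          : ∀ v → (matched v ∨ pending v) ≡ X v
      independent     : ∀ u v → pending u ≡ true → pending v ≡ true → adj K u v ≡ false
      matched-even    : parity (countTrue matched) ≡ 0ℙ

  open State public

  State-cong : ∀ {X Y} → (∀ v → X v ≡ Y v) → State X → State Y
  State-cong X≗Y st = record
    { matched = matched st ; pending = pending st ; matching = matching st ; disjoint = disjoint st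
    ; covers = λ v → trans (covers st v) (X≗Y v)
    ; independent = independent st ; matched-even = matched-even st }

  empty : State (λ _ → false)
  empty = record
    { matched = λ _ → false ; pending = λ _ → false
    ; matching = record
      { partner = λ v → v ; closed = λ _ () ; involutive = λ _ () ; fixpointFree = λ _ () ; edge = λ _ () }
    ; disjoint = λ _ () ; covers = λ _ → refl ; independent = λ _ _ ()
    ; matched-even = cong parity (countTrue-false {n} {λ _ → false} λ _ → refl) }

  module _ {X} (st : State X) where

    pending⇒X : ∀ v → pending st v ≡ true → X v ≡ true
    pending⇒X v pv = trans (sym (covers st v)) (∨-introʳ (matched st v) pv)

    pending⇒unmatched : ∀ v → pending st v ≡ true → matched st v ≡ false
    pending⇒unmatched v pv = ≢true⇒≡false λ mv → bool-clash pv (disjoint st v mv)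

    unprocessed : ∀ v → X v ≡ false → matched st v ≡ false × pending st v ≡ false
    unprocessed v Xv = 𝔹.∨-conicalˡ _ _ both , 𝔹.∨-conicalʳ _ _ both
      where
        both : (matched st v ∨ pending st v) ≡ false
        both = trans (covers st v) Xv

    complete-matching : (∀ v → X v ≡ true) → (∀ v → pending st v ≡ false) → PerfectMatching K
    complete-matching all none = record
      { partner = partner ; involutive = λ v → involutive v (all-matched v)
      ; fixpointFree = λ v → fixpointFree v (all-matched v) ; edge = λ v → edge v (all-matched v) }
      where
        open InducedPerfectMatching (matching st)
        all-matched : ∀ v → matched st v ≡ true
        all-matched v = trans (sym (trans (cong (matched st v ∨_) (none v)) (𝔹.∨-identityʳ _)))
                              (trans (covers st v) (all v))

    pending-even : parity n ≡ 0ℙ → (∀ v → X v ≡ true) → parity (countTrue (pending st)) ≡ 0ℙ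
    pending-even n-even all = begin
      parity (countTrue (pending st))
        ≡⟨ cong (_⊕ parity (countTrue (pending st))) (matched-even st) ⟨
      parity (countTrue (matched st)) ⊕ parity (countTrue (pending st)) ≡⟨ ℙ.+-homo-+ (countTrue (matched st)) _ ⟨
      parity (countTrue (matched st) + countTrue (pending st))          ≡⟨ cong parity partition ⟩
      parity n                                                          ≡⟨ n-even ⟩
      0ℙ                                                                ∎
      where
        open ≡-Reasoning
        partition : countTrue (matched st) + countTrue (pending st) ≡ n
        partition = countTrue-partition (matched st) (pending st) (λ v → trans (covers st v) (all v)) (disjoint st)

    pair : ∀ {x y} → X x ≡ false → pending st y ≡ true → adj K x y ≡ true → State (insert x X)
    pair {x} {y} Xx py xy = record
      { matched = matched′ ; pending = remove y (pending st)
      ; matching = extendMatching (matching st) mx my xy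
      ; disjoint = disjoint′ ; covers = covers′
      ; independent = λ u v pu pv →
          independent st u v (proj₁ (remove-elim (pending st) u pu)) (proj₁ (remove-elim (pending st) v pv))
      ; matched-even = trans (cong parity (trans (countTrue-insert _ y my′) (cong suc (countTrue-insert _ x mx))))
                             (matched-even st) }
      where
        x≢y : ¬ x ≡ y
        x≢y = adjacent-≢ K xy
        mx : matched st x ≡ false
        mx = proj₁ (unprocessed x Xx)
        my : matched st y ≡ false
        my = pending⇒unmatched y py
        my′ : insert x (matched st) y ≡ false
        my′ = trans (insert-other (matched st) (x≢y ∘ sym)) my
        matched′ : Fin n → Bool
        matched′ = insert y (insert x (matched st))

        matched′-old : ∀ {v} → ¬ v ≡ x → ¬ v ≡ y → matched′ v ≡ matched st v
        matched′-old v≢x v≢y = trans (insert-other (insert x (matched st)) v≢y) (insert-other (matched st) v≢x)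

        disjoint′ : ∀ v → matched′ v ≡ true → remove y (pending st) v ≡ false
        disjoint′ v m′v with trichotomy x y v
        ... | is-a refl = trans (remove-other (pending st) x≢y) (proj₂ (unprocessed x Xx))
        ... | is-b refl = remove-self y (pending st)
        ... | other v≢x v≢y =
          trans (remove-other (pending st) v≢y) (disjoint st v (trans (sym (matched′-old v≢x v≢y)) m′v))

        covers′ : ∀ v → (matched′ v ∨ remove y (pending st) v) ≡ insert x X v
        covers′ v with trichotomy x y v
        ... | is-a refl = trans (cong (_∨ remove y (pending st) x) (∨-introˡ (x == y) (insert-self x (matched st))))
                                (sym (insert-self x X))
        ... | is-b refl = trans (cong (_∨ _) (insert-self y (insert x (matched st))))
                                (sym (trans (insert-other X (x≢y ∘ sym)) (pending⇒X y py)))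
        ... | other v≢x v≢y = begin
          matched′ v ∨ remove y (pending st) v
            ≡⟨ cong₂ _∨_ (matched′-old v≢x v≢y) (remove-other (pending st) v≢y) ⟩
          matched st v ∨ pending st v            ≡⟨ covers st v ⟩
          X v                                    ≡⟨ insert-other X v≢x ⟨
          insert x X v                           ∎
          where open ≡-Reasoning

    pend : ∀ {x} → X x ≡ false → (∀ y → pending st y ≡ true → adj K x y ≡ false) → State (insert x X)
    pend {x} Xx lonely = record
      { matched = matched st ; pending = insert x (pending st) ; matching = matching st
      ; disjoint = λ v mv → trans (insert-other (pending st) λ { refl → bool-clash mv mx }) (disjoint st v mv)
      ; covers = λ v → trans (sym (𝔹.∨-assoc (matched st v) (pending st v) (v == x)))
                             (cong (_∨ (v == x)) (covers st v))
      ; independent = independent′ ; matched-even = matched-even st }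
      where
        mx : matched st x ≡ false
        mx = proj₁ (unprocessed x Xx)
        independent′ : ∀ u v → insert x (pending st) u ≡ true → insert x (pending st) v ≡ true →
          adj K u v ≡ false
        independent′ u v pu pv with insert-elim (pending st) u pu | insert-elim (pending st) v pv
        ... | inj₁ pu′ | inj₁ pv′ = independent st u v pu′ pv′
        ... | inj₁ pu′ | inj₂ refl = trans (SimpleGraph.sym K u x) (lonely u pu′)
        ... | inj₂ refl | inj₁ pv′ = lonely v pv′
        ... | inj₂ refl | inj₂ refl = loopless K x

  data Step {X} (st : State X) (x : Fin n) : Set where
    paired : ∀ y → pending st y ≡ true → adj K x y ≡ true → (st′ : State (insert x X)) →
      (∀ v → matched st′ v ≡ insert y (insert x (matched st)) v) →
      (∀ v → pending st′ v ≡ remove y (pending st) v) → Step st x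
    pended : (∀ y → pending st y ≡ true → adj K x y ≡ false) → (st′ : State (insert x X)) →
      (∀ v → matched st′ v ≡ matched st v) →
      (∀ v → pending st′ v ≡ insert x (pending st) v) → Step st x

  step : ∀ {X} (st : State X) x → X x ≡ false → Step st x
  step st x Xx with FinP.any? (λ y → (pending st y ∧ adj K x y) 𝔹.≟ true)
  ... | yes (y , e) with ∧-elim (pending st y) e
  ...   | py , xy = paired y py xy (pair st Xx py xy) (λ _ → refl) (λ _ → refl)
  step st x Xx | no none = pended lonely (pend st Xx lonely) (λ _ → refl) (λ _ → refl)
    where
      lonely : ∀ y → pending st y ≡ true → adj K x y ≡ false
      lonely y py = ≢true⇒≡false λ xy → none (y , cong₂ _∧_ py xy)

below : ∀ {n} → ℕ → Fin n → Bool
below k v = does (toℕ v <? k)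

below-suc : ∀ {n} (x v : Fin n) → below (suc (toℕ x)) v ≡ insert x (below (toℕ x)) v
below-suc x v with v ≟ x
... | yes refl = trans (dec-true (toℕ x <? suc (toℕ x)) ≤-refl) (sym (𝔹.∨-zeroʳ _))
... | no v≢x = trans (unchanged (toℕ v <? toℕ x)) (sym (𝔹.∨-identityʳ _))
  where
    unchanged : Dec (toℕ v < toℕ x) → below (suc (toℕ x)) v ≡ below (toℕ x) v
    unchanged (yes v<x) =
      trans (dec-true (toℕ v <? suc (toℕ x)) (m≤n⇒m≤1+n v<x)) (sym (dec-true (toℕ v <? toℕ x) v<x))
    unchanged (no v≮x) =
      trans (dec-false (toℕ v <? suc (toℕ x)) (v≮x ∘ <-from-≢)) (sym (dec-false (toℕ v <? toℕ x) v≮x))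
      where
        <-from-≢ : toℕ v < suc (toℕ x) → toℕ v < toℕ x
        <-from-≢ v<1+x = ≤∧≢⇒< (≤-pred v<1+x) (v≢x ∘ FinP.toℕ-injective)

below-self : ∀ {n} (x : Fin n) → below (toℕ x) x ≡ false
below-self x = dec-false (toℕ x <? toℕ x) (<-irrefl refl)

below-all : ∀ {n} (v : Fin n) → below n v ≡ true
below-all v = dec-true (toℕ v <? _) (FinP.toℕ<n v)

module Sweep {n} (I : (Fin n → Bool) → Set)
  (I-cong : ∀ {X Y} → (∀ v → X v ≡ Y v) → I X → I Y)
  (base T : Fin n → Bool) (base-T : ∀ v → base v ≡ true → T v ≡ false)
  (I-step : ∀ {X} x → T x ≡ true → X x ≡ false → I X → I (insert x X)) where

  stage : ℕ → Fin n → Bool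
  stage k v = base v ∨ (T v ∧ below k v)

  stage-suc : ∀ x v → stage (suc (toℕ x)) v ≡ base v ∨ (T v ∧ insert x (below (toℕ x)) v)
  stage-suc x v = cong (λ b → base v ∨ (T v ∧ b)) (below-suc x v)

  next : ∀ x → I (stage (toℕ x)) → I (stage (suc (toℕ x)))
  next x Iₓ with T x in Tx
  ... | true = I-cong grow (I-step x Tx fresh Iₓ)
    where
      fresh : stage (toℕ x) x ≡ false
      fresh rewrite below-self x | 𝔹.∧-zeroʳ (T x) =
        trans (𝔹.∨-identityʳ (base x)) (≢true⇒≡false λ bx → bool-clash Tx (base-T x bx))
      grow : ∀ v → insert x (stage (toℕ x)) v ≡ stage (suc (toℕ x)) v
      grow v with v ≟ x
      ... | yes refl = trans (𝔹.∨-zeroʳ _)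
        (sym (trans (stage-suc x x) (∨-introʳ (base x) (cong₂ _∧_ Tx (insert-self x (below (toℕ x)))))))
      ... | no v≢x = trans (𝔹.∨-identityʳ _)
        (sym (trans (stage-suc x v) (cong (λ b → base v ∨ (T v ∧ b)) (insert-other (below (toℕ x)) v≢x))))
  ... | false = I-cong same Iₓ
    where
      same : ∀ v → stage (toℕ x) v ≡ stage (suc (toℕ x)) v
      same v with v ≟ x
      ... | yes refl rewrite Tx = refl
      ... | no v≢x =
        sym (trans (stage-suc x v) (cong (λ b → base v ∨ (T v ∧ b)) (insert-other (below (toℕ x)) v≢x)))

  upTo : ∀ k → k ≤ n → I base → I (stage k)
  upTo zero _ I₀ =
    I-cong (λ v → sym (trans (cong (base v ∨_) (𝔹.∧-zeroʳ (T v))) (𝔹.∨-identityʳ (base v)))) I₀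
  upTo (suc k) k<n I₀ = subst (I ∘ stage ∘ suc) (FinP.toℕ-fromℕ< k<n)
    (next x (subst (I ∘ stage) (sym (FinP.toℕ-fromℕ< k<n)) (upTo k (<⇒≤ k<n) I₀)))
    where
      x : Fin n
      x = fromℕ< k<n

  sweep : I base → I (λ v → base v ∨ T v)
  sweep I₀ = I-cong (λ v → cong (base v ∨_) (trans (cong (T v ∧_) (below-all v)) (𝔹.∧-identityʳ (T v))))
                    (upTo n ≤-refl I₀)

-- Saturated graphs

full? : ∀ {n} → SimpleGraph n → Fin n → Bool
full? K v = does (FinP.all? λ w → ((w == v) ∨ adj K v w) 𝔹.≟ true)

full-adj : ∀ {n} (K : SimpleGraph n) {v w} → full? K v ≡ true → ¬ w ≡ v → adj K v w ≡ true
full-adj K {v} {w} full w≢v with ∨-elim (w == v) (does⇒ (FinP.all? _) full w)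
... | inj₁ w≡v = ⊥-elim (w≢v (==⇒≡ w≡v))
... | inj₂ vw = vw

nonfull-nonneighbour : ∀ {n} (K : SimpleGraph n) {v} → full? K v ≡ false →
  ∃ λ w → ¬ v ≡ w × adj K v w ≡ false
nonfull-nonneighbour K {v} nonfull
  with FinP.¬∀⟶∃¬ _ _ (λ w → ((w == v) ∨ adj K v w) 𝔹.≟ true) (does⇒¬ (FinP.all? _) nonfull)
... | w , bad = w , (λ { refl → bad (∨-introˡ _ (==-refl v)) }) , ≢true⇒≡false (bad ∘ ∨-introʳ (w == v))

-- The non-full vertices of a saturated graph induce a disjoint union of cliques.
Saturated : ∀ {n} → SimpleGraph n → Set
Saturated K = ∀ x y z → full? K y ≡ false → adj K x y ≡ true → adj K y z ≡ true → ¬ x ≡ z →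
  adj K x z ≡ true

module Components {n} (K : SimpleGraph n) (saturated : Saturated K) where

  open Greedy K

  nonfull : Fin n → Bool
  nonfull v = not (full? K v)

  -- For non-full c, the vertex set of the clique containing c in K minus its full vertices.
  component : Fin n → Fin n → Bool
  component c v = nonfull v ∧ ((c == v) ∨ adj K c v)

  component-nonfull : ∀ c v → component c v ≡ true → full? K v ≡ false
  component-nonfull c v h = not-true (proj₁ (∧-elim (nonfull v) h))

  component-intro : ∀ {c v} → full? K v ≡ false → ((c == v) ∨ adj K c v) ≡ true → component c v ≡ true
  component-intro fv h = cong₂ _∧_ (cong not fv) h

  component-self : ∀ {c} → full? K c ≡ false → component c c ≡ true
  component-self {c} fc = component-intro fc (∨-introˡ _ (==-refl c))

  component-step : ∀ {a b} c → full? K a ≡ false → full? K b ≡ false → adj K a b ≡ true →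
    component c a ≡ true → component c b ≡ true
  component-step {a} {b} c fa fb ab ca with ∨-elim (c == a) (proj₂ (∧-elim (nonfull a) ca))
  ... | inj₁ c≡a = component-intro fb (∨-introʳ (c == b) (subst (λ u → adj K u b ≡ true) (sym (==⇒≡ c≡a)) ab))
  ... | inj₂ ca′ = component-intro fb (via (c ≟ b))
    where
      via : Dec (c ≡ b) → ((c == b) ∨ adj K c b) ≡ true
      via (yes refl) = ∨-introˡ _ (==-refl c)
      via (no c≢b) = ∨-introʳ (c == b) (saturated c a b fa ca′ ab c≢b)

  component-adjacent : ∀ {a b} c → full? K a ≡ false → full? K b ≡ false → adj K a b ≡ true →
    component c a ≡ component c b
  component-adjacent c fa fb ab =
    bool-ext (component-step c fa fb ab) (component-step c fb fa (trans (SimpleGraph.sym K _ _) ab))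

  component-unique : ∀ {u u′} v → adj K u u′ ≡ false → component u v ≡ true → component u′ v ≡ true →
    u ≡ u′
  component-unique {u} {u′} v uu′ cu cu′ =
    meet (∨-elim (u == v) (proj₂ (∧-elim (nonfull v) cu))) (∨-elim (u′ == v) (proj₂ (∧-elim (nonfull v) cu′)))
    where
      meet : (u == v) ≡ true ⊎ adj K u v ≡ true → (u′ == v) ≡ true ⊎ adj K u′ v ≡ true → u ≡ u′
      meet (inj₁ u≡v) (inj₁ u′≡v) = trans (==⇒≡ u≡v) (sym (==⇒≡ u′≡v))
      meet (inj₁ u≡v) (inj₂ u′v) = ⊥-elim (bool-clash
        (trans (SimpleGraph.sym K u u′) (subst (λ t → adj K u′ t ≡ true) (sym (==⇒≡ u≡v)) u′v)) uu′)
      meet (inj₂ uv) (inj₁ u′≡v) =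
        ⊥-elim (bool-clash (subst (λ t → adj K u t ≡ true) (sym (==⇒≡ u′≡v)) uv) uu′)
      meet (inj₂ uv) (inj₂ u′v) with u ≟ u′
      ... | yes u≡u′ = u≡u′
      ... | no u≢u′ = ⊥-elim (bool-clash
              (saturated u v u′ (component-nonfull u v cu) uv (trans (SimpleGraph.sym K v u′) u′v) u≢u′) uu′)

  -- Tutte's condition fails for the set S of full vertices: K − S has at least |S| + 2 odd
  -- components, represented by the pairwise non-adjacent vertices reps.
  record OddComponentExcess : Set where
    field
      reps             : Fin n → Bool
      reps-independent : ∀ u v → reps u ≡ true → reps v ≡ true → adj K u v ≡ false
      reps-odd         : ∀ u → reps u ≡ true → parity (countTrue (component u)) ≡ 1ℙ
      excess           : countTrue (full? K) + 2 ≤ countTrue reps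

  pairing-keeps-parity : ∀ (M : Fin n → Bool) {x y} → M x ≡ false → insert x M y ≡ false →
    full? K x ≡ false → full? K y ≡ false → adj K x y ≡ true → ∀ c →
    parity (countTrue (λ v → insert y (insert x M) v ∧ component c v)) ≡ parity (countTrue (λ v → M v ∧ component c v))
  pairing-keeps-parity M {x} {y} Mx My fx fy xy c = begin
    parity (countTrue (λ v → insert y (insert x M) v ∧ component c v))
      ≡⟨ cong parity (countTrue-insert-∧ (insert x M) (component c) y My) ⟩
    parity (𝟙 (component c y) + countTrue (λ v → insert x M v ∧ component c v))
      ≡⟨ cong (λ b → parity (𝟙 b + _)) (component-adjacent c fy fx (trans (SimpleGraph.sym K y x) xy)) ⟩
    parity (𝟙 (component c x) + countTrue (λ v → insert x M v ∧ component c v))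
      ≡⟨ cong (λ k → parity (𝟙 (component c x) + k)) (countTrue-insert-∧ M (component c) x Mx) ⟩
    parity (𝟙 (component c x) + (𝟙 (component c x) + countTrue (λ v → M v ∧ component c v)))
      ≡⟨ parity-double (𝟙 (component c x)) _ ⟩
    parity (countTrue (λ v → M v ∧ component c v)) ∎
    where open ≡-Reasoning

  record Pass₁ (X : Fin n → Bool) : Set where
    field
      state           : State X
      nonfull-only    : ∀ v → X v ≡ true → full? K v ≡ false
      components-even : ∀ c → parity (countTrue (λ v → matched state v ∧ component c v)) ≡ 0ℙ

  Pass₁-cong : ∀ {X Y} → (∀ v → X v ≡ Y v) → Pass₁ X → Pass₁ Y
  Pass₁-cong X≗Y P = record
    { state = State-cong X≗Y state
    ; nonfull-only = λ v Yv → nonfull-only v (trans (X≗Y v) Yv)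
    ; components-even = components-even }
    where open Pass₁ P

  pass₁-step : ∀ {X} x → nonfull x ≡ true → X x ≡ false → Pass₁ X → Pass₁ (insert x X)
  pass₁-step {X} x nx Xx P with step (Pass₁.state P) x Xx
  ... | paired y py xy st′ matched′ _ = record
    { state = st′ ; nonfull-only = nonfull-only′ ; components-even = even′ }
    where
      open Pass₁ P
      fx : full? K x ≡ false
      fx = not-true nx
      fy : full? K y ≡ false
      fy = nonfull-only y (pending⇒X state y py)
      nonfull-only′ : ∀ v → insert x X v ≡ true → full? K v ≡ false
      nonfull-only′ v h with insert-elim X v h
      ... | inj₁ Xv = nonfull-only v Xv
      ... | inj₂ refl = fx
      mx : matched state x ≡ false
      mx = proj₁ (unprocessed state x Xx)
      my : insert x (matched state) y ≡ false
      my = trans (insert-other (matched state) (adjacent-≢ K xy ∘ sym)) (pending⇒unmatched state y py)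
      even′ : ∀ c → parity (countTrue (λ v → matched st′ v ∧ component c v)) ≡ 0ℙ
      even′ c = trans (cong parity (countTrue-cong λ v → cong (_∧ component c v) (matched′ v)))
                      (trans (pairing-keeps-parity (matched state) mx my fx fy xy c) (components-even c))
  ... | pended _ st′ matched′ _ = record
    { state = st′
    ; nonfull-only = λ v h → [ nonfull-only v , (λ { refl → not-true nx }) ]′ (insert-elim X v h)
    ; components-even = λ c → trans (cong parity (countTrue-cong λ v → cong (_∧ component c v) (matched′ v)))
                                     (components-even c) }
    where open Pass₁ P

  pass₁ : Pass₁ nonfull
  pass₁ = Sweep.sweep Pass₁ Pass₁-cong (λ _ → false) nonfull (λ _ ()) pass₁-step record
    { state = empty ; nonfull-only = λ _ () ; components-even = λ c → cong parity (countTrue-false {n} λ _ → refl) }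

  -- Second pass: match the full vertices, first against the vertices left over by the first pass.

  pass₁-state : State nonfull
  pass₁-state = Pass₁.state pass₁

  data Phase₂ {X} (st : State X) : Set where
    pendingNonfull : (∀ v → pending st v ≡ true → full? K v ≡ false) →
      countTrue (pending st) + countTrue (λ v → X v ∧ full? K v) ≡ countTrue (pending pass₁-state) → Phase₂ st
    pendingFull : (∀ v → pending st v ≡ true → full? K v ≡ true) → Phase₂ st

  Pass₂ : (Fin n → Bool) → Set
  Pass₂ X = Σ (State X) Phase₂

  Pass₂-cong : ∀ {X Y} → (∀ v → X v ≡ Y v) → Pass₂ X → Pass₂ Y
  Pass₂-cong X≗Y (st , pendingNonfull sub count) = State-cong X≗Y st , pendingNonfull sub
    (trans (cong (countTrue (pending st) +_) (countTrue-cong λ v → cong (_∧ full? K v) (sym (X≗Y v)))) count)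
  Pass₂-cong X≗Y (st , pendingFull sub) = State-cong X≗Y st , pendingFull sub

  pass₂-step : ∀ {X} x → full? K x ≡ true → X x ≡ false → Pass₂ X → Pass₂ (insert x X)
  pass₂-step {X} x fx Xx (st , phase) with step st x Xx
  ... | paired y py xy st′ _ pending′ = st′ , phase′ phase
    where
      shrinks : ∀ v → pending st′ v ≡ true → pending st v ≡ true
      shrinks v h = proj₁ (remove-elim (pending st) v (trans (sym (pending′ v)) h))
      phase′ : Phase₂ st → Phase₂ st′
      phase′ (pendingFull sub) = pendingFull λ v → sub v ∘ shrinks v
      phase′ (pendingNonfull sub count) = pendingNonfull (λ v → sub v ∘ shrinks v) (begin
        countTrue (pending st′) + countTrue (λ v → insert x X v ∧ full? K v)
          ≡⟨ cong₂ _+_ (countTrue-cong pending′) (countTrue-insert-∧ X (full? K) x Xx) ⟩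
        countTrue (remove y (pending st)) + (𝟙 (full? K x) + countTrue (λ v → X v ∧ full? K v))
          ≡⟨ cong (λ b → countTrue (remove y (pending st)) + (𝟙 b + countTrue (λ v → X v ∧ full? K v))) fx ⟩
        countTrue (remove y (pending st)) + suc (countTrue (λ v → X v ∧ full? K v))
          ≡⟨ +-suc _ _ ⟩
        suc (countTrue (remove y (pending st))) + countTrue (λ v → X v ∧ full? K v)
          ≡⟨ cong (_+ countTrue (λ v → X v ∧ full? K v)) (countTrue-remove (pending st) y py) ⟨
        countTrue (pending st) + countTrue (λ v → X v ∧ full? K v)
          ≡⟨ count ⟩
        countTrue (pending pass₁-state) ∎)
        where open ≡-Reasoning
  ... | pended lonely st′ _ pending′ = st′ , pendingFull only-x
    where
      nothing-pending : ∀ y → pending st y ≡ false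
      nothing-pending y = ≢true⇒≡false λ py →
        bool-clash (full-adj K fx λ { refl → bool-clash (pending⇒X st y py) Xx }) (lonely y py)
      only-x : ∀ v → pending st′ v ≡ true → full? K v ≡ true
      only-x v h with insert-elim (pending st) v (trans (sym (pending′ v)) h)
      ... | inj₁ pv = ⊥-elim (bool-clash pv (nothing-pending v))
      ... | inj₂ refl = fx

  pass₂ : Pass₂ (λ v → nonfull v ∨ full? K v)
  pass₂ = Sweep.sweep Pass₂ Pass₂-cong nonfull (full? K) (λ _ → not-true) pass₂-step
    (pass₁-state , pendingNonfull (λ v → Pass₁.nonfull-only pass₁ v ∘ pending⇒X pass₁-state v) (trans
      (cong (countTrue (pending pass₁-state) +_) (countTrue-false λ v → 𝔹.∧-inverseˡ (full? K v)))
      (+-identityʳ _)))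

  leftovers-odd : ∀ u → pending pass₁-state u ≡ true → parity (countTrue (component u)) ≡ 1ℙ
  leftovers-odd u pu = begin
    parity (countTrue (component u))
      ≡⟨ cong parity (countTrue-split (component u) (matched pass₁-state)) ⟩
    parity (countTrue matchedPart + countTrue unmatchedPart)
      ≡⟨ cong (λ k → parity (countTrue matchedPart + k)) single ⟩
    parity (countTrue matchedPart + 1)                   ≡⟨ ℙ.+-homo-+ (countTrue matchedPart) 1 ⟩
    parity (countTrue matchedPart) ⊕ 1ℙ                  ≡⟨ cong (_⊕ 1ℙ) evenPart ⟩
    1ℙ                                                   ∎
    where
      open ≡-Reasoning
      matchedPart unmatchedPart : Fin n → Bool
      matchedPart v = component u v ∧ matched pass₁-state v
      unmatchedPart v = component u v ∧ not (matched pass₁-state v)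
      fu : full? K u ≡ false
      fu = Pass₁.nonfull-only pass₁ u (pending⇒X pass₁-state u pu)
      evenPart : parity (countTrue matchedPart) ≡ 0ℙ
      evenPart = trans (cong parity (countTrue-cong λ v → 𝔹.∧-comm (component u v) _))
                       (Pass₁.components-even pass₁ u)
      -- Every unmatched vertex of the component is pending, hence equal to u.
      only-u : ∀ v → unmatchedPart v ≡ true → v ≡ u
      only-u v h with ∧-elim (component u v) h
      ... | cv , unmatched = sym (component-unique v (independent pass₁-state u v pu pv) cv (component-self fv))
        where
          fv : full? K v ≡ false
          fv = component-nonfull u v cv
          pv : pending pass₁-state v ≡ true
          pv = trans (sym (cong (_∨ pending pass₁-state v) (not-true unmatched)))
                     (trans (covers pass₁-state v) (cong not fv))
      single : countTrue unmatchedPart ≡ 1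
      single = countTrue-singleton unmatchedPart u
        (cong₂ _∧_ (component-self fu) (cong not (pending⇒unmatched pass₁-state u pu))) only-u

  processed : ∀ v → (nonfull v ∨ full? K v) ≡ true
  processed v = 𝔹.∨-inverseˡ (full? K v)

  perfectMatching-or-excess : parity n ≡ 0ℙ → PerfectMatching K ⊎ OddComponentExcess
  perfectMatching-or-excess n-even with pass₂
  ... | st , phase with FinP.any? (λ v → pending st v 𝔹.≟ true)
  ...   | no none = inj₁ (complete-matching st processed λ v → ≢true⇒≡false λ pv → none (v , pv))
  ...   | yes (u , pu) = conclude phase
    where
      two : 2 ≤ countTrue (pending st)
      two = even-pos⇒≥2 (pending-even st n-even processed) (countTrue-pos (pending st) u pu)
      conclude : Phase₂ st → PerfectMatching K ⊎ OddComponentExcess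
      conclude (pendingFull sub) with countTrue-second (pending st) u pu two
      ... | u′ , pu′ , u′≢u = ⊥-elim (bool-clash (full-adj K (sub u pu) u′≢u) (independent st u u′ pu pu′))
      conclude (pendingNonfull _ count) = inj₂ record
        { reps = pending pass₁-state
        ; reps-independent = independent pass₁-state
        ; reps-odd = leftovers-odd
        ; excess = begin
            countTrue (full? K) + 2                      ≡⟨ +-comm _ 2 ⟩
            2 + countTrue (full? K)                      ≤⟨ +-monoˡ-≤ _ two ⟩
            countTrue (pending st) + countTrue (full? K)
              ≡⟨ cong (countTrue (pending st) +_) (countTrue-cong λ v → cong (_∧ full? K v) (processed v)) ⟨
            countTrue (pending st) + countTrue (λ v → (nonfull v ∨ full? K v) ∧ full? K v)
              ≡⟨ count ⟩
            countTrue (pending pass₁-state)                    ∎ }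
        where open ≤-Reasoning

-- Counting against a regular subgraph

odd-boundary : ∀ {a b X d} → parity a ≡ 1ℙ → parity d ≡ 1ℙ → parity X ≡ 0ℙ → b + X ≡ d * a →
  parity b ≡ 1ℙ
odd-boundary {a} {b} {X} {d} a-odd d-odd X-even split = begin
  parity b              ≡⟨ ℙ.+-identityʳ (parity b) ⟨
  parity b ⊕ 0ℙ         ≡⟨ cong (parity b ⊕_) X-even ⟨
  parity b ⊕ parity X   ≡⟨ ℙ.+-homo-+ b X ⟨
  parity (b + X)        ≡⟨ cong parity split ⟩
  parity (d * a)        ≡⟨ ℙ.*-homo-* d a ⟩
  parity d ⊗ parity a   ≡⟨ cong₂ _⊗_ d-odd a-odd ⟩
  1ℙ                    ∎
  where open ≡-Reasoning

odd⇒pos : ∀ {b} → parity b ≡ 1ℙ → 1 ≤ b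
odd⇒pos {suc _} _ = s≤s z≤n

odd-gap : ∀ {a d} → parity a ≡ 1ℙ → parity d ≡ 1ℙ → d < a → d + 2 ≤ a
odd-gap {a} {d} a-odd d-odd d<a with m≤n⇒m<n∨m≡n d<a
... | inj₁ 1+d<a = subst (_≤ a) (+-comm 2 d) 1+d<a
... | inj₂ refl = ⊥-elim (ℙ.p≢p⁻¹ 1ℙ (trans (sym d-odd) (trans (sym (ℙ.suc-homo-⁻¹ d)) (cong _⁻¹ a-odd))))

small-component-boundary : ∀ {a b X d} → 1 ≤ a → a ≤ d → b + X ≡ d * a → X + a ≤ a * a → d ≤ b
small-component-boundary {suc a} {b} {X} {d} _ a≤d split bound with d ≤? b
... | yes d≤b = d≤b
... | no d≰b = ⊥-elim (<⇒≱ (*-cancelˡ-< a d (suc a) (+-cancelˡ-< d (a * d) (a * suc a) lt)) a≤d)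
  where
    X≤ : X ≤ a * suc a
    X≤ = +-cancelʳ-≤ (suc a) X (a * suc a) (subst (X + suc a ≤_) (+-comm (suc a) (a * suc a)) bound)
    lt : d + a * d < d + a * suc a
    lt = begin-strict
      d + a * d      ≡⟨ cong (d +_) (*-comm a d) ⟩
      d + d * a      ≡⟨ *-suc d a ⟨
      d * suc a      ≡⟨ split ⟨
      b + X          <⟨ +-mono-<-≤ (≰⇒> d≰b) X≤ ⟩
      d + a * suc a  ∎
      where open ≤-Reasoning

excess-impossible : ∀ {d β k s n} → 1 ≤ d → (d + 2) * β + s ≤ n → n ≤ 3 * d + 5 →
  d * k + β ≤ d * s → s + 2 ≤ β + k → ⊥
excess-impossible {d} {suc (suc (suc β))} {k} {s} {n} _ sizes n≤ _ _ = <⇒≱ (begin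
  suc (3 * d + 5)        ≡⟨ three-copies d ⟩
  (d + 2) * 3            ≤⟨ *-monoʳ-≤ (d + 2) (s≤s (s≤s (s≤s z≤n))) ⟩
  (d + 2) * (3 + β)      ≤⟨ m≤m+n _ s ⟩
  (d + 2) * (3 + β) + s  ≤⟨ sizes ⟩
  n                      ∎) n≤
  where
    open ≤-Reasoning
    three-copies : ∀ d → suc (3 * d + 5) ≡ (d + 2) * 3
    three-copies = solve-∀
excess-impossible {d} {zero} {k} {s} 1≤d _ _ boundary many = <⇒≱ (begin-strict
  d * s          <⟨ m<m+n (d * s) (≤-trans 1≤d (m≤m+n d (d + 0))) ⟩
  d * s + 2 * d  ≡⟨ distrib d s ⟩
  d * (s + 2)    ≤⟨ *-monoʳ-≤ d many ⟩
  d * k          ∎) (subst (_≤ d * s) (+-identityʳ (d * k)) boundary)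
  where
    open ≤-Reasoning
    distrib : ∀ d s → d * s + 2 * d ≡ d * (s + 2)
    distrib = solve-∀
excess-impossible {d} {suc zero} {k} {s} _ _ _ boundary many = <⇒≱ (begin-strict
  d * s          <⟨ m<m+n (d * s) (s≤s z≤n) ⟩
  d * s + 1      ≤⟨ +-monoˡ-≤ 1 (m≤m+n (d * s) d) ⟩
  d * s + d + 1  ≡⟨ cong (_+ 1) (sym (*-suc′ d s)) ⟩
  d * (s + 1) + 1 ≤⟨ +-monoˡ-≤ 1 (*-monoʳ-≤ d (≤-pred (subst (_≤ suc k) (+-suc s 1) many))) ⟩
  d * k + 1      ∎) boundary
  where
    open ≤-Reasoning
    *-suc′ : ∀ d s → d * (s + 1) ≡ d * s + d
    *-suc′ = solve-∀
excess-impossible {d} {suc (suc zero)} {k} {s} _ _ _ boundary many = <⇒≱ (begin-strict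
  d * s          <⟨ m<m+n (d * s) (s≤s z≤n) ⟩
  d * s + 2      ≤⟨ +-monoˡ-≤ 2 (*-monoʳ-≤ d (+-cancelʳ-≤ 2 s k (subst (s + 2 ≤_) (+-comm 2 k) many))) ⟩
  d * k + 2      ∎) boundary
  where open ≤-Reasoning


module RegularSubgraph {n} (H K : SimpleGraph n) {d : ℕ} (regular : Regular d H) (d-odd : parity d ≡ 1ℙ)
  (H⊆K : SubgraphOf H K) (saturated : Saturated K) where

  open Components K saturated

  neighboursIn : (Fin n → Bool) → Fin n → ℕ
  neighboursIn B v = countTrue (λ w → adj H v w ∧ B w)

  neighboursIn-sum : ∀ A B → sumOver A (neighboursIn B) ≤ d * countTrue B
  neighboursIn-sum A B = begin
    sumOver A (neighboursIn B)                         ≡⟨ double-count A B (adj H) ⟩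
    sumOver B (λ w → countTrue (λ v → A v ∧ adj H v w)) ≤⟨ sumOver-mono B (λ w _ → at-most-degree w) ⟩
    sumOver B (λ _ → d)                                ≡⟨ sumOver-const B d (λ _ _ → refl) ⟩
    d * countTrue B                                    ∎
    where
      open ≤-Reasoning
      at-most-degree : ∀ w → countTrue (λ v → A v ∧ adj H v w) ≤ d
      at-most-degree w = subst (countTrue (λ v → A v ∧ adj H v w) ≤_) (regular w)
        (countTrue-mono {g = adj H w} λ v h → trans (SimpleGraph.sym H w v) (proj₂ (∧-elim (A v) h)))

  size boundary internal : Fin n → ℕ
  size u = countTrue (component u)
  boundary u = sumOver (component u) (neighboursIn (full? K))
  internal u = sumOver (component u) (neighboursIn (component u))

  -- An H-neighbour of a vertex in a component is either full or in the same component.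
  degree-split : ∀ u v → component u v ≡ true → neighboursIn (full? K) v + neighboursIn (component u) v ≡ d
  degree-split u v cv = begin
    neighboursIn (full? K) v + neighboursIn (component u) v
      ≡⟨ cong (neighboursIn (full? K) v +_) (countTrue-cong nonfull-neighbours) ⟨
    neighboursIn (full? K) v + countTrue (λ w → adj H v w ∧ not (full? K w))
      ≡⟨ countTrue-split (adj H v) (full? K) ⟨
    countTrue (adj H v)
      ≡⟨ regular v ⟩
    d ∎
    where
      open ≡-Reasoning
      nonfull-neighbours : ∀ w → (adj H v w ∧ not (full? K w)) ≡ (adj H v w ∧ component u w)
      nonfull-neighbours w with adj H v w in vw
      ... | false = refl
      ... | true = bool-ext (λ nw → component-step u (component-nonfull u v cv) (not-true nw) (H⊆K v w vw) cv)
                            (λ cw → cong not (component-nonfull u w cw))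

  boundary+internal : ∀ u → boundary u + internal u ≡ d * size u
  boundary+internal u = trans (sym (sumOver-+ (component u) (neighboursIn (full? K)) (neighboursIn (component u))))
                              (sumOver-const (component u) d (degree-split u))

  internal-even : ∀ u → parity (internal u) ≡ 0ℙ
  internal-even u = trans (cong parity (sumOver-countTrue (component u) (λ v w → adj H v w ∧ component u w)))
                          (handshake M M-sym M-loopless)
    where
      M : Fin n → Fin n → Bool
      M v w = component u v ∧ (adj H v w ∧ component u w)
      M-sym : ∀ v w → M v w ≡ M w v
      M-sym v w rewrite SimpleGraph.sym H v w = begin
        component u v ∧ (adj H w v ∧ component u w)   ≡⟨ 𝔹.∧-assoc (component u v) _ _ ⟨
        (component u v ∧ adj H w v) ∧ component u w   ≡⟨ 𝔹.∧-comm _ (component u w) ⟩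
        component u w ∧ (component u v ∧ adj H w v)   ≡⟨ cong (component u w ∧_) (𝔹.∧-comm (component u v) _) ⟩
        component u w ∧ (adj H w v ∧ component u v)   ∎
        where open ≡-Reasoning
      M-loopless : ∀ v → M v v ≡ false
      M-loopless v rewrite loopless H v = 𝔹.∧-zeroʳ (component u v)

  internal+size≤size² : ∀ u → internal u + size u ≤ size u * size u
  internal+size≤size² u = begin
    internal u + size u                              ≡⟨ cong (internal u +_) (sumOver-one (component u)) ⟨
    internal u + sumOver (component u) (λ _ → 1)
      ≡⟨ sumOver-+ (component u) (neighboursIn (component u)) (λ _ → 1) ⟨
    sumOver (component u) (λ v → neighboursIn (component u) v + 1) ≤⟨ sumOver-mono (component u) (λ v → fewer v) ⟩
    sumOver (component u) (λ _ → size u)             ≡⟨ sumOver-const (component u) (size u) (λ _ _ → refl) ⟩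
    size u * size u                                  ∎
    where
      open ≤-Reasoning
      fewer : ∀ v → component u v ≡ true → neighboursIn (component u) v + 1 ≤ size u
      fewer v cv = subst₂ _≤_ (+-comm 1 _) (sym (countTrue-remove (component u) v cv))
        (s≤s (countTrue-mono λ w h → remove-intro (component u) w (proj₂ (∧-elim (adj H v w) h))
                                       (adjacent-≢ H (proj₁ (∧-elim (adj H v w) h)) ∘ sym)))

  module Excess (E : OddComponentExcess) where

    open OddComponentExcess E

    light : Fin n → Bool
    light u = does (boundary u <? d)

    lightReps heavyReps : Fin n → Bool
    lightReps u = reps u ∧ light u
    heavyReps u = reps u ∧ not (light u)

    β k s : ℕ
    β = countTrue lightReps
    k = countTrue heavyReps
    s = countTrue (full? K)

    light⇒boundary-pos : ∀ u → lightReps u ≡ true → 1 ≤ boundary u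
    light⇒boundary-pos u h = odd⇒pos {boundary u}
      (odd-boundary {size u} {boundary u} {internal u} {d} (reps-odd u (proj₁ (∧-elim (reps u) h))) d-odd
                    (internal-even u) (boundary+internal u))

    light⇒large : ∀ u → lightReps u ≡ true → d + 2 ≤ size u
    light⇒large u h with ∧-elim (reps u) h
    ... | r , lt = odd-gap {size u} {d} (reps-odd u r) d-odd (≰⇒> λ size≤d →
      <⇒≱ (does⇒ (boundary u <? d) lt)
          (small-component-boundary {size u} {boundary u} {internal u} {d} (odd⇒pos {size u} (reps-odd u r))
                                    size≤d (boundary+internal u) (internal+size≤size² u)))

    heavy⇒boundary : ∀ u → heavyReps u ≡ true → d ≤ boundary u
    heavy⇒boundary u h = ≮⇒≥ (does⇒¬ (boundary u <? d) (not-true (proj₂ (∧-elim (reps u) h))))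

    inside : ∀ u v → reps u ≡ true → component u v ≡ true → nonfull v ≡ true
    inside u v _ cv = cong not (component-nonfull u v cv)

    disjoint : ∀ u u′ v → reps u ≡ true → reps u′ ≡ true → component u v ≡ true → component u′ v ≡ true →
      u ≡ u′
    disjoint u u′ v r r′ = component-unique v (reps-independent u u′ r r′)

    sizes : (d + 2) * β + s ≤ n
    sizes = begin
      (d + 2) * β + s
        ≡⟨ cong (_+ s) (sumOver-const lightReps (d + 2) (λ _ _ → refl)) ⟨
      sumOver lightReps (λ _ → d + 2) + s
        ≤⟨ +-monoˡ-≤ s (sumOver-mono lightReps light⇒large) ⟩
      sumOver lightReps size + s
        ≤⟨ +-monoˡ-≤ s (sumOver-⊆ size (λ u → proj₁ ∘ ∧-elim (reps u))) ⟩
      sumOver reps size + s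
        ≡⟨ cong (_+ s) (sumOver-cong reps (λ u _ → sumOver-one (component u))) ⟨
      sumOver reps (λ u → sumOver (component u) (λ _ → 1)) + s
        ≤⟨ +-monoˡ-≤ s (sumOver-disjoint reps nonfull component (λ _ → 1) inside disjoint) ⟩
      sumOver nonfull (λ _ → 1) + s
        ≡⟨ trans (cong (_+ s) (sumOver-one nonfull)) (+-comm (countTrue nonfull) s) ⟩
      s + countTrue nonfull
        ≡⟨ countTrue-partition (full? K) nonfull (λ v → 𝔹.∨-inverseʳ (full? K v)) (λ _ → cong not) ⟩
      n ∎
      where open ≤-Reasoning

    boundaries : d * k + β ≤ d * s
    boundaries = begin
      d * k + β
        ≡⟨ cong₂ _+_ (sumOver-const heavyReps d (λ _ _ → refl)) (sumOver-one lightReps) ⟨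
      sumOver heavyReps (λ _ → d) + sumOver lightReps (λ _ → 1)
        ≤⟨ +-mono-≤ (sumOver-mono heavyReps heavy⇒boundary) (sumOver-mono lightReps light⇒boundary-pos) ⟩
      sumOver heavyReps boundary + sumOver lightReps boundary
        ≡⟨ trans (sumOver-split reps light boundary) (+-comm (sumOver lightReps boundary) _) ⟨
      sumOver reps boundary
        ≤⟨ sumOver-disjoint reps nonfull component (neighboursIn (full? K)) inside disjoint ⟩
      sumOver nonfull (neighboursIn (full? K))
        ≤⟨ neighboursIn-sum nonfull (full? K) ⟩
      d * s ∎
      where open ≤-Reasoning

    many : s + 2 ≤ β + k
    many = ≤-trans excess (≤-reflexive (countTrue-split reps light))

  no-excess : n ≤ 3 * d + 5 → ¬ OddComponentExcess
  no-excess n≤ E = excess-impossible {d} {β} {k} {s} (odd⇒pos {d} d-odd) sizes n≤ boundaries many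
    where open Excess E

sum-mono-< : ∀ {n} {f g : Fin n → ℕ} → (∀ i → f i ≤ g i) → ∀ j → f j < g j → sum f < sum g
sum-mono-< {suc n} f≤g fzero lt = +-mono-<-≤ lt (sum-mono-≤ (f≤g ∘ fsuc))
sum-mono-< {suc n} f≤g (fsuc j) lt = +-mono-≤-< (f≤g fzero) (sum-mono-< (f≤g ∘ fsuc) j lt)

nonEdges : ∀ {n} → SimpleGraph n → ℕ
nonEdges K = sum λ v → countTrue (λ w → not (adj K v w))

nonEdges-addEdge : ∀ {n} (K : SimpleGraph n) {a b} (a≢b : ¬ a ≡ b) → adj K a b ≡ false →
  nonEdges (addEdge K a b a≢b) < nonEdges K
nonEdges-addEdge K {a} {b} a≢b ab =
  sum-mono-< (λ v → countTrue-mono (fewer v)) a (countTrue-mono-< b (fewer a) added (cong not ab))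
  where
    fewer : ∀ v w → not (adj K v w ∨ isEdge a b v w) ≡ true → not (adj K v w) ≡ true
    fewer v w h with adj K v w
    ... | false = refl
    ... | true = h
    added : not (adj K a b ∨ isEdge a b a b) ≡ false
    added rewrite ==-refl a | ==-refl b = cong not (𝔹.∨-zeroʳ (adj K a b))

record Violation {n} (K : SimpleGraph n) : Set where
  field
    x y z     : Fin n
    y-nonfull : full? K y ≡ false
    xy        : adj K x y ≡ true
    yz        : adj K y z ≡ true
    x≢z       : ¬ x ≡ z
    xz        : adj K x z ≡ false

violates : ∀ {n} → SimpleGraph n → Fin n → Fin n → Fin n → Bool
violates K x y z = not (full? K y) ∧ (adj K x y ∧ (adj K y z ∧ (not (x == z) ∧ not (adj K x z))))

saturated-or-violation : ∀ {n} (K : SimpleGraph n) → Saturated K ⊎ Violation K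
saturated-or-violation K
  with FinP.any? (λ x → FinP.any? (λ y → FinP.any? (λ z → violates K x y z 𝔹.≟ true)))
... | yes (x , y , z , v) with ∧-elim _ v
...   | ny , v₁ with ∧-elim _ v₁
...     | xy , v₂ with ∧-elim _ v₂
...       | yz , v₃ with ∧-elim _ v₃
...         | x≠z , nxz = inj₂ record
  { x = x ; y = y ; z = z ; y-nonfull = not-true ny ; xy = xy ; yz = yz
  ; x≢z = λ { refl → bool-clash (==-refl x) (not-true x≠z) } ; xz = not-true nxz }
saturated-or-violation K | no none = inj₁ λ x y z ny xy yz x≢z → closes x y z ny xy yz x≢z
  where
    closes : ∀ x y z → full? K y ≡ false → adj K x y ≡ true → adj K y z ≡ true → ¬ x ≡ z →
      adj K x z ≡ true
    closes x y z ny xy yz x≢z with adj K x z in xz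
    ... | true = refl
    ... | false = ⊥-elim (none (x , y , z , violated))
      where
        violated : violates K x y z ≡ true
        violated rewrite ny | xy | yz | ≢⇒==false x≢z | xz = refl

-- Induction on the number of non-edges: a saturated supergraph is handled by counting, and
-- a violation x ~ y ~ z, x ≁ z, y ≁ w is resolved by switching between K + xz and K + yw.
supergraph-perfectMatching : ∀ {n d} (H : SimpleGraph n) → Regular d H → parity d ≡ 1ℙ →
  parity n ≡ 0ℙ → n ≤ 3 * d + 5 → ∀ K → SubgraphOf H K → PerfectMatching K
supergraph-perfectMatching {n} {d} H regular d-odd n-even n≤ K = <-rec P step (nonEdges K) K refl
  where
    P : ℕ → Set
    P m = ∀ K → nonEdges K ≡ m → SubgraphOf H K → PerfectMatching K
    step : ∀ m → (∀ {m′} → m′ < m → P m′) → P m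
    step m rec K refl H⊆K with saturated-or-violation K
    ... | inj₁ saturated = [ id , ⊥-elim ∘ RegularSubgraph.no-excess H K regular d-odd H⊆K saturated n≤ ]′
                             (Components.perfectMatching-or-excess K saturated n-even)
    ... | inj₂ violation with nonfull-nonneighbour K (Violation.y-nonfull violation)
    ...   | w , y≢w , yw = switch K x≢z y≢w xy yz (added x≢z xz) (added y≢w yw)
      where
        open Violation violation
        added : ∀ {a b} (a≢b : ¬ a ≡ b) → adj K a b ≡ false → PerfectMatching (addEdge K a b a≢b)
        added a≢b ab = rec (nonEdges-addEdge K a≢b ab) _ refl λ u v huv → ∨-introˡ _ (H⊆K u v huv)

complement : ∀ {n} → SimpleGraph n → SimpleGraph n
complement G = record
  { adj = λ u v → not (adj G u v) ∧ not (v == u)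
  ; sym = λ u v → cong₂ _∧_ (cong not (SimpleGraph.sym G u v)) (cong not (==-sym v u))
  ; loopless = λ v → trans (cong (λ b → not (adj G v v) ∧ not b) (==-refl v)) (𝔹.∧-zeroʳ _) }

degree-complement : ∀ {n} (G : SimpleGraph n) u → suc (degree G u + degree (complement G) u) ≡ n
degree-complement {n} G u = begin
  suc (countTrue (adj G u) + countTrue (λ v → not (adj G u v) ∧ not (v == u)))
    ≡⟨ cong (λ k → suc (k + countTrue (λ v → not (adj G u v) ∧ not (v == u)))) (countTrue-cong others) ⟩
  suc (countTrue (λ v → not (v == u) ∧ adj G u v) + countTrue (λ v → not (adj G u v) ∧ not (v == u)))
    ≡⟨ cong (λ k → suc (countTrue (λ v → not (v == u) ∧ adj G u v) + k))
            (countTrue-cong λ v → 𝔹.∧-comm (not (adj G u v)) _) ⟩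
  suc (countTrue (λ v → not (v == u) ∧ adj G u v) + countTrue (λ v → not (v == u) ∧ not (adj G u v)))
    ≡⟨ cong suc (countTrue-split (λ v → not (v == u)) (adj G u)) ⟨
  suc (countTrue (remove u λ _ → true))
    ≡⟨ countTrue-remove (λ _ → true) u refl ⟨
  countTrue {n} (λ _ → true)
    ≡⟨ countTrue-true n ⟩
  n ∎
  where
    open ≡-Reasoning
    others : ∀ v → adj G u v ≡ (not (v == u) ∧ adj G u v)
    others v with adj G u v in uv
    ... | false = sym (𝔹.∧-zeroʳ _)
    ... | true =
      sym (trans (𝔹.∧-identityʳ _) (cong not (≢⇒==false {i = v} λ { refl → bool-clash uv (loopless G u) })))

complement-regular : ∀ {n r d} (G : SimpleGraph n) → Regular r G → r + 1 + d ≡ n → Regular d (complement G)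
complement-regular {n} {r} {d} G G-regular split u = +-cancelˡ-≡ (r + 1) _ _ (begin
  r + 1 + degree (complement G) u            ≡⟨ shuffle r _ ⟩
  suc (r + degree (complement G) u)          ≡⟨ cong (λ k → suc (k + degree (complement G) u)) (G-regular u) ⟨
  suc (degree G u + degree (complement G) u) ≡⟨ degree-complement G u ⟩
  n                                          ≡⟨ split ⟨
  r + 1 + d                                  ∎)
  where
    open ≡-Reasoning
    shuffle : ∀ r k → r + 1 + k ≡ suc (r + k)
    shuffle = solve-∀

extend : ∀ {n} (G : SimpleGraph n) r → Regular r G → PerfectMatching (complement G) → ExtendsTo G (r + 1)
extend {n} G r G-regular P = G′ , (λ u v uv → ∨-introˡ _ uv) , G′-regular
  where
    open PerfectMatching P
    partner-flip : ∀ u v → (v == partner u) ≡ true → (u == partner v) ≡ true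
    partner-flip u v e =
      subst (λ t → (u == t) ≡ true) (trans (sym (involutive u)) (cong partner (sym (==⇒≡ e)))) (==-refl u)
    partner-sym : ∀ u v → (v == partner u) ≡ (u == partner v)
    partner-sym u v = bool-ext (partner-flip u v) (partner-flip v u)
    G′ : SimpleGraph n
    G′ = record
      { adj = λ u → insert (partner u) (adj G u)
      ; sym = λ u v → cong₂ _∨_ (SimpleGraph.sym G u v) (partner-sym u v)
      ; loopless = λ v → cong₂ _∨_ (loopless G v) (≢⇒==false (fixpointFree v ∘ sym)) }
    G′-regular : Regular (r + 1) G′
    G′-regular u = begin
      countTrue (insert (partner u) (adj G u))   ≡⟨ countTrue-insert (adj G u) (partner u) new ⟩
      suc (countTrue (adj G u))                  ≡⟨ cong suc (G-regular u) ⟩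
      suc r                                      ≡⟨ +-comm 1 r ⟩
      r + 1                                      ∎
      where
        open ≡-Reasoning
        new : adj G u (partner u) ≡ false
        new = not-true (proj₁ (∧-elim (not (adj G u (partner u))) (edge u)))

Hypothesis : ℕ → ℕ → Set
Hypothesis n r = (n ≥ 52 × 3 * r < 2 * (n + 2)) ⊎ (n < 52 × r + 16 < n)

r+1≤n : ∀ {n r} → Hypothesis n r → r + 1 ≤ n
r+1≤n {n} {r} (inj₂ (_ , r+16<n)) = ≤-trans (+-monoʳ-≤ r (s≤s z≤n)) (<⇒≤ r+16<n)
r+1≤n {n} {r} (inj₁ (n≥52 , 3r<2n+4)) with r + 1 ≤? n
... | yes r+1≤n = r+1≤n
... | no r+1≰n = ⊥-elim (<⇒≱ 3r<2n+4 (begin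
  2 * (n + 2)    ≡⟨ double n ⟩
  2 * n + 4      ≤⟨ +-monoʳ-≤ (2 * n) (≤-trans (s≤s (s≤s (s≤s (s≤s z≤n)))) n≥52) ⟩
  2 * n + n      ≡⟨ triple n ⟩
  3 * n          ≤⟨ *-monoʳ-≤ 3 (≤-pred (subst (suc n ≤_) (+-comm r 1) (≰⇒> r+1≰n))) ⟩
  3 * r          ∎))
  where
    open ≤-Reasoning
    double : ∀ n → 2 * (n + 2) ≡ 2 * n + 4
    double = solve-∀
    triple : ∀ n → 2 * n + n ≡ 3 * n
    triple = solve-∀

complement-degree-odd : ∀ {n r d} → parity n ≡ 0ℙ → parity r ≡ 0ℙ → r + 1 + d ≡ n → parity d ≡ 1ℙ
complement-degree-odd {n} {r} {d} n-even r-even split with parity d in d-parity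
... | 1ℙ = refl
... | 0ℙ = ⊥-elim (ℙ.p≢p⁻¹ 0ℙ (begin
  0ℙ                              ≡⟨ n-even ⟨
  parity n                        ≡⟨ cong parity split ⟨
  parity (r + 1 + d)              ≡⟨ ℙ.+-homo-+ (r + 1) d ⟩
  parity (r + 1) ⊕ parity d       ≡⟨ cong₂ _⊕_ (ℙ.+-homo-+ r 1) d-parity ⟩
  (parity r ⊕ 1ℙ) ⊕ 0ℙ            ≡⟨ cong (λ p → (p ⊕ 1ℙ) ⊕ 0ℙ) r-even ⟩
  1ℙ                              ∎))
  where open ≡-Reasoning

complement-degree-large : ∀ {n r d} → parity r ≡ 0ℙ → r + 1 + d ≡ n → Hypothesis n r → n ≤ 3 * d + 5
complement-degree-large {n} {r} {d} r-even refl (inj₁ (_ , 3r<2n+4)) = begin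
  r + 1 + d          ≤⟨ +-monoˡ-≤ d (+-monoˡ-≤ 1 r≤2d+4) ⟩
  2 * d + 4 + 1 + d  ≡⟨ rearrange d ⟩
  3 * d + 5          ∎
  where
    open ≤-Reasoning
    rearrange : ∀ d → 2 * d + 4 + 1 + d ≡ 3 * d + 5
    rearrange = solve-∀
    expand : ∀ r d → 2 * (r + 1 + d + 2) ≡ 2 * r + (2 * d + 6)
    expand = solve-∀
    split3 : ∀ r → 3 * r ≡ 2 * r + r
    split3 = solve-∀
    r<2d+6 : r < 2 * d + 6
    r<2d+6 = +-cancelˡ-< (2 * r) r (2 * d + 6) (subst₂ _<_ (split3 r) (expand r d) 3r<2n+4)
    -- r is even, so r ≠ 2d + 5.
    r≤2d+4 : r ≤ 2 * d + 4
    r≤2d+4 with m≤n⇒m<n∨m≡n (≤-pred (subst (r <_) (+-suc (2 * d) 5) r<2d+6))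
    ... | inj₁ r<2d+5 = ≤-pred (subst (r <_) (+-suc (2 * d) 4) r<2d+5)
    ... | inj₂ refl = ⊥-elim (ℙ.p≢p⁻¹ 0ℙ (trans (sym r-even) (trans (ℙ.+-homo-+ (2 * d) 5)
                        (cong (_⊕ 1ℙ) (trans (ℙ.*-homo-* 2 d) (ℙ.*-zeroˡ (parity d)))))))
complement-degree-large {n} {r} {d} _ refl (inj₂ (n<52 , r+16<n)) = begin
  r + 1 + d     ≤⟨ ≤-trans (<⇒≤ n<52) (n≤1+n 52) ⟩
  3 * 16 + 5    ≤⟨ +-monoˡ-≤ 5 (*-monoʳ-≤ 3 16≤d) ⟩
  3 * d + 5     ∎
  where
    open ≤-Reasoning
    reassociate : ∀ r → suc (r + 16) ≡ r + 1 + 16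
    reassociate = solve-∀
    16≤d : 16 ≤ d
    16≤d = +-cancelˡ-≤ (r + 1) 16 d (subst (_≤ r + 1 + d) (reassociate r) r+16<n)

mainTheorem4 : (n r : ℕ) → 2 ∣ n → 2 ∣ r
    → ((n ≥ 52 × 3 * r < 2 * (n + 2)) ⊎ (n < 52 × r + 16 < n))
    → (G : SimpleGraph n) → Regular r G → ExtendsTo G (r + 1)
mainTheorem4 n r 2∣n 2∣r hypothesis G G-regular = extend G r G-regular complement-matching
  where
    d : ℕ
    d = n ∸ (r + 1)
    split : r + 1 + d ≡ n
    split = m+[n∸m]≡n (r+1≤n hypothesis)
    complement-matching : PerfectMatching (complement G)
    complement-matching = supergraph-perfectMatching (complement G) (complement-regular G G-regular split)
      (complement-degree-odd {n} {r} (parity-even 2∣n) (parity-even 2∣r) split) (parity-even 2∣n)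
      (complement-degree-large (parity-even 2∣r) split hypothesis) (complement G) (λ _ _ uv → uv)
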